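{- Let $M$ be a simple binary matroid having neither $M(C_4)$ nor $M(K_4\backslash e)$ as an induced minor. Then $M$ is either disconnected or round.
   Context: All matroids are simple; every contraction is immediately followed by simplification. An induced minor of $M$ is a matroid obtained from $M$ by a sequence of restrictions to flats and contractions (each contraction followed by simplification). A vertical $k$-separation of $M$ is a partition $(X,Y)$ of $E(M)$ with $r(X)+r(Y)-r(M)<k$ and $r(X),r(Y)\ge k$. A matroid is round if it has no vertical $k$-separation for any positive integer $k$. -}

module Defs where

open import Data.Nat using (ℕ; zero; suc; _+_; _∸_; _≤_; _<_)
open import Data.Bool using (Bool; true; false; _xor_; if_then_else_)
open import Data.Fin using (Fin; zero; suc)
open import Data.Fin.Subset using (Subset; ⁅_⁆; _∈_; _∉_; _⊆_; ∁; _∩_; _∪_; ∣_∣; Nonempty; ⊤; ⊥)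
open import Data.Vec using (Vec; []; _∷_; replicate; zipWith)
open import Data.Product using (Σ; ∃; _×_; _,_)
open import Data.Sum using (_⊎_)
open import Relation.Binary.PropositionalEquality using (_≡_; _≢_)
open import Relation.Nullary using (¬_)

record Matroid : Set where
  field
    m      : ℕ
    r      : Subset m → ℕ
    r-card : ∀ X → r X ≤ ∣ X ∣
    r-mono : ∀ X Y → X ⊆ Y → r X ≤ r Y
    r-sub  : ∀ X Y → r (X ∪ Y) + r (X ∩ Y) ≤ r X + r Y

open Matroid public

Simple : Matroid → Set
Simple M = (∀ e → r M ⁅ e ⁆ ≡ 1)
         × (∀ e f → e ≢ f → r M (⁅ e ⁆ ∪ ⁅ f ⁆) ≡ 2)

zeroV : ∀ {k} → Vec Bool k
zeroV = replicate _ false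

_⊕_ : ∀ {k} → Vec Bool k → Vec Bool k → Vec Bool k
_⊕_ = zipWith _xor_

sumSub : ∀ {m k} → (Fin m → Vec Bool k) → Subset m → Vec Bool k
sumSub {zero}  φ []      = zeroV
sumSub {suc m} φ (b ∷ Z) =
  (if b then φ zero else zeroV) ⊕ sumSub (λ i → φ (suc i)) Z

IndepF2 : ∀ {m k} → (Fin m → Vec Bool k) → Subset m → Set
IndepF2 φ Y = ∀ Z → Z ⊆ Y → Nonempty Z → ¬ (sumSub φ Z ≡ zeroV)

IsRankF2 : ∀ {m k} → (Fin m → Vec Bool k) → Subset m → ℕ → Set
IsRankF2 φ X n =
    (Σ _ λ Y → Y ⊆ X × IndepF2 φ Y × ∣ Y ∣ ≡ n)
  × (∀ Y → Y ⊆ X → IndepF2 φ Y → ∣ Y ∣ ≤ n)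

Binary : Matroid → Set
Binary M = Σ ℕ λ k → Σ (Fin (m M) → Vec Bool k) λ φ →
  ∀ X → IsRankF2 φ X (r M X)

-- Induced minors.
-- A "state" is a matroid on a subset S of E(M), with rank function ρ
-- (only its values on subsets of S are relevant).

IsFlatIn : ∀ {m} → Subset m → (Subset m → ℕ) → Subset m → Set
IsFlatIn S ρ F = F ⊆ S × (∀ e → e ∈ S → e ∉ F → ρ F < ρ (F ∪ ⁅ e ⁆))

-- S' is (the ground set of) a simplification of the matroid (S, ρ):
-- one representative of each parallel class of non-loops.
IsSimplification : ∀ {m} → Subset m → (Subset m → ℕ) → Subset m → Set
IsSimplification S ρ S' =
    S' ⊆ S
  × (∀ e → e ∈ S' → ρ ⁅ e ⁆ ≡ 1)
  × (∀ e f → e ∈ S' → f ∈ S' → e ≢ f → ρ (⁅ e ⁆ ∪ ⁅ f ⁆) ≡ 2)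
  × (∀ e → e ∈ S → ρ ⁅ e ⁆ ≡ 1 → Σ _ λ f → f ∈ S' × ρ (⁅ e ⁆ ∪ ⁅ f ⁆) ≡ 1)

contractRank : ∀ {m} → (Subset m → ℕ) → Subset m → (Subset m → ℕ)
contractRank ρ C X = ρ (X ∪ C) ∸ ρ C

data Reach (M : Matroid) : Subset (m M) → (Subset (m M) → ℕ) → Set where
  start    : Reach M ⊤ (r M)
  restrict : ∀ {S ρ} F → Reach M S ρ → IsFlatIn S ρ F → Reach M F ρ
  contract : ∀ {S ρ} C S' → Reach M S ρ → C ⊆ S →
             IsSimplification S (contractRank ρ C) S' →
             Reach M S' (contractRank ρ C)

img : ∀ {n m} → (Fin n → Fin m) → Subset n → Subset m
img {zero}  f []      = ⊥
img {suc n} f (b ∷ X) =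
  (if b then ⁅ f zero ⁆ else ⊥) ∪ img (λ i → f (suc i)) X

HasInducedMinor : ∀ {n k} → Matroid → (Fin n → Vec Bool k) → Set
HasInducedMinor {n} M ψ =
  Σ (Subset (m M)) λ S → Σ (Subset (m M) → ℕ) λ ρ → Reach M S ρ ×
  Σ (Fin n → Fin (m M)) λ f →
      (∀ i j → f i ≡ f j → i ≡ j)
    × (∀ e → e ∈ S → Σ (Fin n) λ i → f i ≡ e)
    × (∀ i → f i ∈ S)
    × (∀ X → IsRankF2 ψ X (ρ (img f X)))

-- Cycle matroids via the vertex-edge incidence matrix over GF(2)

edgeVec : Fin 4 → Fin 4 → Vec Bool 4
edgeVec u v = zipWith _xor_ (unit u) (unit v)
  where
  unit : Fin 4 → Vec Bool 4
  unit zero                   = true  ∷ false ∷ false ∷ false ∷ []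
  unit (suc zero)             = false ∷ true  ∷ false ∷ false ∷ []
  unit (suc (suc zero))       = false ∷ false ∷ true  ∷ false ∷ []
  unit (suc (suc (suc zero))) = false ∷ false ∷ false ∷ true  ∷ []

v0 v1 v2 v3 : Fin 4
v0 = zero
v1 = suc zero
v2 = suc (suc zero)
v3 = suc (suc (suc zero))

MC4 : Fin 4 → Vec Bool 4
MC4 zero                   = edgeVec v0 v1
MC4 (suc zero)             = edgeVec v1 v2
MC4 (suc (suc zero))       = edgeVec v2 v3
MC4 (suc (suc (suc zero))) = edgeVec v3 v0

MK4e : Fin 5 → Vec Bool 4
MK4e zero                         = edgeVec v0 v1
MK4e (suc zero)                   = edgeVec v0 v2
MK4e (suc (suc zero))             = edgeVec v0 v3
MK4e (suc (suc (suc zero)))       = edgeVec v1 v2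
MK4e (suc (suc (suc (suc zero)))) = edgeVec v1 v3

Disconnected : Matroid → Set
Disconnected M = Σ (Subset (m M)) λ X →
  Nonempty X × Nonempty (∁ X) × r M X + r M (∁ X) ≡ r M ⊤

VerticalSep : (M : Matroid) → ℕ → Subset (m M) → Set
VerticalSep M k X =
  (r M X + r M (∁ X) < k + r M ⊤) × k ≤ r M X × k ≤ r M (∁ X)

Round : Matroid → Set
Round M = ∀ k → 1 ≤ k → ∀ X → ¬ VerticalSep M k X

-- Suppose M is connected but has a vertical separation (X, Y).  Some element lies outside
-- cl(Y) and some outside cl(X), and connectivity links them by a circuit; take such a
-- "crossing" circuit D of minimum size.  Each kind occurs twice in D: a₁, a₂ outside cl(Y)
-- and b₁, b₂ outside cl(X).  Contract C = D − {a₁, b₁, a₂, b₂} in the flat cl(D).  Every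
-- e ∈ cl(D) − D is the sum of some T ⊆ D − b₂, and by minimality T cannot split D into two
-- crossing halves; so e becomes a loop, a parallel copy of a₁, b₁, a₂ or b₂, or a
-- "diagonal" with a₁, a₂ ∈ T ∌ b₁.  Without diagonals (M | cl(D)) / C simplifies to M(C₄);
-- all diagonals are parallel, and one of them together with a₁, b₁, a₂, b₂ gives M(K₄\e).
-- As the goal is ⊥, excluded middle is used freely inside the double-negation monad.

module Submission where

open import Defs
open import Data.Bool using (Bool; true; false; T; not; _∧_; _∨_; _xor_; if_then_else_)
open import Data.Bool.Properties using (xor-same; xor-comm; xor-assoc; xor-identityˡ; xor-identityʳ) renaming (_≟_ to _≟ᵇ_)
open import Data.Empty using (⊥; ⊥-elim)
open import Data.Fin using (Fin; zero; suc)
open import Data.Fin.Properties using (suc-injective; all?) renaming (_≟_ to _≟ᶠ_)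
open import Data.Fin.Subset using (Subset; ⁅_⁆; _∈_; _∉_; _⊆_; _∪_; _∩_; _─_; _-_; ∁; ∣_∣; Nonempty; ⊤) renaming (⊥ to ∅)
open import Data.Fin.Subset.Properties using (⊆-refl; ⊆-trans; ⊆-reflexive; ⊆-antisym; _∈?_; _⊆?_; nonempty?; anySubset?; ∈⊤; ∉⊥; ∣⊥∣≡0; x∈⁅x⁆; x∈⁅y⁆⇒x≡y; x≢y⇒x∉⁅y⁆; ∣⁅x⁆∣≡1; x∈p∪q⁻; p⊆p∪q; q⊆p∪q; x∈p∩q⁺; x∈p∩q⁻; x∈p∧x∉q⇒x∈p─q; p─q⊆p; x∈∁p⇒x∉p; x∉p⇒x∈∁p; p⊆q⇒∣p∣≤∣q∣; p⊂q⇒∣p∣<∣q∣; x∈p⇒∣p-x∣<∣p∣; ∪-assoc; ∪-comm; ∪-identityˡ)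
open import Data.List using (List; []; _∷_; map; _++_; foldr)
open import Data.Nat using (ℕ; zero; suc; _+_; _∸_; _≤_; _<_; _≤?_; _⊔_)
open import Data.Nat.Induction using (<-wellFounded)
open import Data.Nat.Properties using (+-suc; +-comm; ≮⇒≥; <⇒≱; ≤-trans; ≤-antisym; ≤-reflexive; <-≤-trans; ≤-<-trans; ≰⇒>; <-irrefl; ≤∧≢⇒<; ≤-pred; +-mono-≤; +-monoʳ-≤; +-monoˡ-≤; +-cancelʳ-≤; +-cancelˡ-<; m≤m+n; m≤n⇒m∸n≡0; m+n∸m≡n; m+n∸n≡m; module ≤-Reasoning) renaming (_≟_ to _≟ⁿ_)
open import Data.Product using (Σ; _×_; _,_; proj₁; proj₂)
open import Data.Sum using (_⊎_; inj₁; inj₂; [_,_]′)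
open import Data.Vec using (Vec; []; _∷_; here; there; tabulate)
open import Data.Vec.Functional using () renaming (_∷_ to _∷ᶠ_; [] to []ᶠ)
open import Data.Vec.Properties using (zipWith-assoc; zipWith-comm; zipWith-identityˡ; zipWith-identityʳ; ≡-dec)
open import Effect.Monad using (RawMonad)
open import Function using (_∘_)
open import Induction.WellFounded using (Acc; acc)
open import Level using (0ℓ)
open import Relation.Binary.PropositionalEquality using (_≡_; _≢_; refl; sym; trans; cong; cong₂; subst; module ≡-Reasoning)
open import Relation.Nullary using (¬_; Dec; yes; no; does; ¬?; _×-dec_; _→-dec_)
open import Relation.Nullary.Decidable using (¬¬-excluded-middle; from-yes; map′; T?)
open import Relation.Nullary.Negation using (DoubleNegation; ¬¬-Monad; ¬¬-map)

private
  variable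
    n N k : ℕ
    x : Fin n

⊕-assoc : (u v w : Vec Bool k) → (u ⊕ v) ⊕ w ≡ u ⊕ (v ⊕ w)
⊕-assoc = zipWith-assoc xor-assoc

⊕-comm : (u v : Vec Bool k) → u ⊕ v ≡ v ⊕ u
⊕-comm = zipWith-comm xor-comm

⊕-identityˡ : (u : Vec Bool k) → zeroV ⊕ u ≡ u
⊕-identityˡ = zipWith-identityˡ xor-identityˡ

⊕-identityʳ : (u : Vec Bool k) → u ⊕ zeroV ≡ u
⊕-identityʳ = zipWith-identityʳ xor-identityʳ

⊕-self : (u : Vec Bool k) → u ⊕ u ≡ zeroV
⊕-self []      = refl
⊕-self (a ∷ u) = cong₂ _∷_ (xor-same a) (⊕-self u)

⊕-cancelʳ : (u v : Vec Bool k) → (u ⊕ v) ⊕ v ≡ u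
⊕-cancelʳ u v = trans (⊕-assoc u v v) (trans (cong (u ⊕_) (⊕-self v)) (⊕-identityʳ u))

⊕≡0⇒≡ : (u v : Vec Bool k) → u ⊕ v ≡ zeroV → u ≡ v
⊕≡0⇒≡ u v eq = trans (sym (⊕-cancelʳ u v)) (trans (cong (_⊕ v) eq) (⊕-identityˡ v))

≡⇒⊕≡0 : (u v : Vec Bool k) → u ≡ v → u ⊕ v ≡ zeroV
≡⇒⊕≡0 u .u refl = ⊕-self u

⊕-interchange : (a b c d : Vec Bool k) → (a ⊕ b) ⊕ (c ⊕ d) ≡ (a ⊕ c) ⊕ (b ⊕ d)
⊕-interchange a b c d = begin
  (a ⊕ b) ⊕ (c ⊕ d)  ≡⟨ ⊕-assoc a b (c ⊕ d) ⟩
  a ⊕ (b ⊕ (c ⊕ d))  ≡⟨ cong (a ⊕_) (sym (⊕-assoc b c d)) ⟩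
  a ⊕ ((b ⊕ c) ⊕ d)  ≡⟨ cong (λ w → a ⊕ (w ⊕ d)) (⊕-comm b c) ⟩
  a ⊕ ((c ⊕ b) ⊕ d)  ≡⟨ cong (a ⊕_) (⊕-assoc c b d) ⟩
  a ⊕ (c ⊕ (b ⊕ d))  ≡⟨ sym (⊕-assoc a c (b ⊕ d)) ⟩
  (a ⊕ c) ⊕ (b ⊕ d)  ∎
  where open ≡-Reasoning

sum-∅ : (φ : Fin n → Vec Bool k) → sumSub φ ∅ ≡ zeroV
sum-∅ {zero}  φ = refl
sum-∅ {suc n} φ = trans (⊕-identityˡ _) (sum-∅ (φ ∘ suc))

sum-⁅⁆ : (φ : Fin n → Vec Bool k) (e : Fin n) → sumSub φ ⁅ e ⁆ ≡ φ e
sum-⁅⁆ φ zero    = trans (cong (φ zero ⊕_) (sum-∅ (φ ∘ suc))) (⊕-identityʳ _)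
sum-⁅⁆ φ (suc e) = trans (⊕-identityˡ _) (sum-⁅⁆ (φ ∘ suc) e)

infixr 6 _Δ_

_Δ_ : Subset n → Subset n → Subset n
_Δ_ = _⊕_

sum-Δ : (φ : Fin n → Vec Bool k) (A B : Subset n) → sumSub φ (A Δ B) ≡ sumSub φ A ⊕ sumSub φ B
sum-Δ φ []      []      = sym (⊕-self zeroV)
sum-Δ φ (a ∷ A) (b ∷ B) =
  trans (cong₂ _⊕_ (if-xor a b) (sum-Δ (φ ∘ suc) A B)) (⊕-interchange _ _ _ _)
  where
  if-xor : ∀ a b → (if a xor b then φ zero else zeroV)
                 ≡ (if a then φ zero else zeroV) ⊕ (if b then φ zero else zeroV)
  if-xor true  true  = sym (⊕-self (φ zero))
  if-xor true  false = sym (⊕-identityʳ (φ zero))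
  if-xor false b     = sym (⊕-identityˡ _)

x∈pΔq⁻ : ∀ (p q : Subset n) → x ∈ p Δ q → (x ∈ p × x ∉ q) ⊎ (x ∉ p × x ∈ q)
x∈pΔq⁻ (true  ∷ p) (false ∷ q) here      = inj₁ (here , λ ())
x∈pΔq⁻ (false ∷ p) (true  ∷ q) here      = inj₂ ((λ ()) , here)
x∈pΔq⁻ (_     ∷ p) (_     ∷ q) (there h) with x∈pΔq⁻ p q h
... | inj₁ (a , b) = inj₁ (there a , λ { (there c) → b c })
... | inj₂ (a , b) = inj₂ ((λ { (there c) → a c }) , there b)

x∈p∧x∉q⇒x∈pΔq : ∀ (p q : Subset n) → x ∈ p → x ∉ q → x ∈ p Δ q
x∈p∧x∉q⇒x∈pΔq (true ∷ p) (true  ∷ q) here      b = ⊥-elim (b here)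
x∈p∧x∉q⇒x∈pΔq (true ∷ p) (false ∷ q) here      b = here
x∈p∧x∉q⇒x∈pΔq (_    ∷ p) (_     ∷ q) (there a) b = there (x∈p∧x∉q⇒x∈pΔq p q a (b ∘ there))

x∉p∧x∈q⇒x∈pΔq : ∀ (p q : Subset n) → x ∉ p → x ∈ q → x ∈ p Δ q
x∉p∧x∈q⇒x∈pΔq p q a b = subst (_ ∈_) (⊕-comm q p) (x∈p∧x∉q⇒x∈pΔq q p b a)

x∈p∧x∈q⇒x∉pΔq : ∀ (p q : Subset n) → x ∈ p → x ∈ q → x ∉ p Δ q
x∈p∧x∈q⇒x∉pΔq p q a b h with x∈pΔq⁻ p q h
... | inj₁ (_ , b') = b' b
... | inj₂ (a' , _) = a' a

x∉p∧x∉q⇒x∉pΔq : ∀ (p q : Subset n) → x ∉ p → x ∉ q → x ∉ p Δ q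
x∉p∧x∉q⇒x∉pΔq p q x∉p x∉q h with x∈pΔq⁻ p q h
... | inj₁ (a , _) = x∉p a
... | inj₂ (_ , b) = x∉q b

disjoint⇒∪≡Δ : ∀ (p q : Subset n) → (∀ {x} → x ∈ p → x ∉ q) → p ∪ q ≡ p Δ q
disjoint⇒∪≡Δ p q disj = ⊆-antisym ∪⊆Δ Δ⊆∪
  where
  ∪⊆Δ : p ∪ q ⊆ p Δ q
  ∪⊆Δ h with x∈p∪q⁻ p q h
  ... | inj₁ a = x∈p∧x∉q⇒x∈pΔq p q a (disj a)
  ... | inj₂ b = x∉p∧x∈q⇒x∈pΔq p q (λ a → disj a b) b
  Δ⊆∪ : p Δ q ⊆ p ∪ q
  Δ⊆∪ h with x∈pΔq⁻ p q h
  ... | inj₁ (a , _) = p⊆p∪q q a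
  ... | inj₂ (_ , b) = q⊆p∪q p q b

x∈p─q⁻ : ∀ (p q : Subset n) → x ∈ p ─ q → x ∈ p × x ∉ q
x∈p─q⁻ p q h = p─q⊆p p q h , x∈p─q⇒x∉q p q h
  where
  x∈p─q⇒x∉q : ∀ {n} {x : Fin n} (p q : Subset n) → x ∈ p ─ q → x ∉ q
  x∈p─q⇒x∉q (_ ∷ p) (false ∷ q) (there h) (there c) = x∈p─q⇒x∉q p q h c
  x∈p─q⇒x∉q (_ ∷ p) (true  ∷ q) (there h) (there c) = x∈p─q⇒x∉q p q h c

∉∪ : ∀ {p q : Subset n} → x ∉ p → x ∉ q → x ∉ p ∪ q
∉∪ {p = p} {q} x∉p x∉q h with x∈p∪q⁻ p q h
... | inj₁ a = x∉p a
... | inj₂ b = x∉q b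

x∈p⇒⁅x⁆⊆p : ∀ {p : Subset n} → x ∈ p → ⁅ x ⁆ ⊆ p
x∈p⇒⁅x⁆⊆p {x = x} {p} x∈p h = subst (_∈ p) (sym (x∈⁅y⁆⇒x≡y x h)) x∈p

∪⁅⁆⊆ : ∀ {p q : Subset n} {e} → p ⊆ q → e ∈ q → p ∪ ⁅ e ⁆ ⊆ q
∪⁅⁆⊆ {p = p} {q} {e} p⊆q e∈q h with x∈p∪q⁻ p ⁅ e ⁆ h
... | inj₁ a = p⊆q a
... | inj₂ b = subst (_∈ q) (sym (x∈⁅y⁆⇒x≡y e b)) e∈q

⊆∪⁅⁆⇒-⊆ : ∀ {p q : Subset n} {e} → p ⊆ q ∪ ⁅ e ⁆ → p - e ⊆ q
⊆∪⁅⁆⇒-⊆ {p = p} {q} {e} p⊆ h with x∈p─q⁻ p ⁅ e ⁆ h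
... | a , b with x∈p∪q⁻ q ⁅ e ⁆ (p⊆ a)
...   | inj₁ c = c
...   | inj₂ c = ⊥-elim (b c)

⊆∪⁅⁆⇒⊆ : ∀ {p q : Subset n} {e} → p ⊆ q ∪ ⁅ e ⁆ → e ∉ p → p ⊆ q
⊆∪⁅⁆⇒⊆ {p = p} {q} {e} p⊆ e∉p h = ⊆∪⁅⁆⇒-⊆ p⊆ (x∈p∧x∉q⇒x∈p─q h (λ b → e∉p (subst (_∈ p) (x∈⁅y⁆⇒x≡y e b) h)))

∣p∪q∣≡∣p∣+∣q∣ : ∀ (p q : Subset n) → (∀ {x} → x ∈ p → x ∉ q) → ∣ p ∪ q ∣ ≡ ∣ p ∣ + ∣ q ∣
∣p∪q∣≡∣p∣+∣q∣ []          []          _ = refl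
∣p∪q∣≡∣p∣+∣q∣ (true  ∷ p) (true  ∷ q) d = ⊥-elim (d here here)
∣p∪q∣≡∣p∣+∣q∣ (true  ∷ p) (false ∷ q) d = cong suc (∣p∪q∣≡∣p∣+∣q∣ p q (λ a b → d (there a) (there b)))
∣p∪q∣≡∣p∣+∣q∣ (false ∷ p) (true  ∷ q) d =
  trans (cong suc (∣p∪q∣≡∣p∣+∣q∣ p q (λ a b → d (there a) (there b)))) (sym (+-suc ∣ p ∣ ∣ q ∣))
∣p∪q∣≡∣p∣+∣q∣ (false ∷ p) (false ∷ q) d = ∣p∪q∣≡∣p∣+∣q∣ p q (λ a b → d (there a) (there b))

∣p∪⁅x⁆∣≡1+∣p∣ : ∀ (p : Subset n) → x ∉ p → ∣ p ∪ ⁅ x ⁆ ∣ ≡ suc ∣ p ∣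
∣p∪⁅x⁆∣≡1+∣p∣ {x = x} p x∉p = begin
  ∣ p ∪ ⁅ x ⁆ ∣      ≡⟨ ∣p∪q∣≡∣p∣+∣q∣ p ⁅ x ⁆ (λ a b → x∉p (subst (_∈ p) (x∈⁅y⁆⇒x≡y x b) a)) ⟩
  ∣ p ∣ + ∣ ⁅ x ⁆ ∣  ≡⟨ cong (∣ p ∣ +_) (∣⁅x⁆∣≡1 x) ⟩
  ∣ p ∣ + 1          ≡⟨ +-comm ∣ p ∣ 1 ⟩
  suc ∣ p ∣          ∎
  where open ≡-Reasoning

3≤∣p∣ : ∀ {p : Subset n} {x y z} → x ∈ p → y ∈ p → z ∈ p → x ≢ y → z ≢ x → z ≢ y → 3 ≤ ∣ p ∣
3≤∣p∣ {p = p} {x} {y} {z} x∈p y∈p z∈p x≢y z≢x z≢y = begin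
  3                            ≡⟨ cong (λ c → suc (suc c)) (∣⁅x⁆∣≡1 x) ⟨
  suc (suc ∣ ⁅ x ⁆ ∣)          ≡⟨ cong suc (∣p∪⁅x⁆∣≡1+∣p∣ ⁅ x ⁆ (x≢y ∘ sym ∘ x∈⁅y⁆⇒x≡y x)) ⟨
  suc ∣ ⁅ x ⁆ ∪ ⁅ y ⁆ ∣        ≡⟨ ∣p∪⁅x⁆∣≡1+∣p∣ _ (∉∪ (x≢y⇒x∉⁅y⁆ z≢x) (x≢y⇒x∉⁅y⁆ z≢y)) ⟨
  ∣ (⁅ x ⁆ ∪ ⁅ y ⁆) ∪ ⁅ z ⁆ ∣  ≤⟨ p⊆q⇒∣p∣≤∣q∣ (∪⁅⁆⊆ (∪⁅⁆⊆ (x∈p⇒⁅x⁆⊆p x∈p) y∈p) z∈p) ⟩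
  ∣ p ∣                        ∎
  where open ≤-Reasoning

∣q∣+∣p─q∣≡∣p∣ : ∀ (p q : Subset n) → q ⊆ p → ∣ q ∣ + ∣ p ─ q ∣ ≡ ∣ p ∣
∣q∣+∣p─q∣≡∣p∣ p q q⊆p = begin
  ∣ q ∣ + ∣ p ─ q ∣  ≡⟨ ∣p∪q∣≡∣p∣+∣q∣ q (p ─ q) (λ a b → proj₂ (x∈p─q⁻ p q b) a) ⟨
  ∣ q ∪ (p ─ q) ∣    ≡⟨ cong ∣_∣ (⊆-antisym q∪[p─q]⊆p p⊆q∪[p─q]) ⟩
  ∣ p ∣              ∎
  where
  open ≡-Reasoning
  q∪[p─q]⊆p : q ∪ (p ─ q) ⊆ p
  q∪[p─q]⊆p h with x∈p∪q⁻ q (p ─ q) h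
  ... | inj₁ a = q⊆p a
  ... | inj₂ b = p─q⊆p p q b
  p⊆q∪[p─q] : p ⊆ q ∪ (p ─ q)
  p⊆q∪[p─q] {x} h with x ∈? q
  ... | yes a = p⊆p∪q _ a
  ... | no  b = q⊆p∪q q _ (x∈p∧x∉q⇒x∈p─q h b)

decSubset : {P : Fin n → Set} → (∀ i → Dec (P i)) → Subset n
decSubset P? = tabulate (does ∘ P?)

∈decSubset⁺ : {P : Fin n → Set} (P? : ∀ i → Dec (P i)) → P x → x ∈ decSubset P?
∈decSubset⁺ {x = zero}  P? Px with P? zero
... | yes _  = here
... | no ¬Px = ⊥-elim (¬Px Px)
∈decSubset⁺ {x = suc x} P? Px = there (∈decSubset⁺ (P? ∘ suc) Px)

∈decSubset⁻ : {P : Fin n → Set} (P? : ∀ i → Dec (P i)) → x ∈ decSubset P? → P x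
∈decSubset⁻ {x = zero}  P? h with P? zero | h
... | yes Px | _ = Px
∈decSubset⁻ {x = suc x} P? (there h) = ∈decSubset⁻ (P? ∘ suc) h

Injective : (Fin n → Fin N) → Set
Injective f = ∀ i j → f i ≡ f j → i ≡ j

inj-suc : ∀ (f : Fin (suc n) → Fin N) → Injective f → Injective (f ∘ suc)
inj-suc f inj i j eq = suc-injective (inj (suc i) (suc j) eq)

img⁺ : ∀ (f : Fin n → Fin N) {Y i} → i ∈ Y → f i ∈ img f Y
img⁺ f {true ∷ Y} here      = p⊆p∪q _ (x∈⁅x⁆ (f zero))
img⁺ f {_    ∷ Y} (there h) = q⊆p∪q _ _ (img⁺ (f ∘ suc) h)

f∈img⊤ : ∀ (f : Fin n → Fin N) i → f i ∈ img f ⊤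
f∈img⊤ f i = img⁺ f (∈⊤ {x = i})

img⁻ : ∀ (f : Fin n → Fin N) Y {x} → x ∈ img f Y → Σ (Fin n) λ i → i ∈ Y × f i ≡ x
img⁻-there : ∀ (f : Fin (suc n) → Fin N) {b Y x} → x ∈ img (f ∘ suc) Y → Σ (Fin (suc n)) λ i → i ∈ b ∷ Y × f i ≡ x

img⁻-there f {Y = Y} h with img⁻ (f ∘ suc) Y h
... | i , i∈Y , fi≡x = suc i , there i∈Y , fi≡x

img⁻ f []    h = ⊥-elim (∉⊥ h)
img⁻ f (true ∷ Y) h with x∈p∪q⁻ ⁅ f zero ⁆ (img (f ∘ suc) Y) h
... | inj₁ a = zero , here , sym (x∈⁅y⁆⇒x≡y (f zero) a)
... | inj₂ c = img⁻-there f c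
img⁻ f (false ∷ Y) h with x∈p∪q⁻ ∅ (img (f ∘ suc) Y) h
... | inj₁ a = ⊥-elim (∉⊥ a)
... | inj₂ c = img⁻-there f c

img-mono : ∀ (f : Fin n → Fin N) {Y Z} → Y ⊆ Z → img f Y ⊆ img f Z
img-mono f {Y} Y⊆Z h with img⁻ f Y h
... | i , i∈Y , refl = img⁺ f (Y⊆Z i∈Y)

∣img∣ : ∀ (f : Fin n → Fin N) → Injective f → ∀ Y → ∣ img f Y ∣ ≡ ∣ Y ∣
∣img∣ {N = N} f inj []  = ∣⊥∣≡0 N
∣img∣ f inj (true  ∷ Y) = begin
  ∣ ⁅ f zero ⁆ ∪ img (f ∘ suc) Y ∣        ≡⟨ ∣p∪q∣≡∣p∣+∣q∣ ⁅ f zero ⁆ _ head∉tail ⟩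
  ∣ ⁅ f zero ⁆ ∣ + ∣ img (f ∘ suc) Y ∣    ≡⟨ cong₂ _+_ (∣⁅x⁆∣≡1 (f zero)) (∣img∣ (f ∘ suc) (inj-suc f inj) Y) ⟩
  suc ∣ Y ∣                              ∎
  where
  open ≡-Reasoning
  head∉tail : ∀ {x} → x ∈ ⁅ f zero ⁆ → x ∉ img (f ∘ suc) Y
  head∉tail a b with img⁻ (f ∘ suc) Y b
  ... | i , _ , fi≡x with inj zero (suc i) (trans (sym (x∈⁅y⁆⇒x≡y (f zero) a)) (sym fi≡x))
  ... | ()
∣img∣ {N = N} f inj (false ∷ Y) = begin
  ∣ ∅ ∪ img (f ∘ suc) Y ∣           ≡⟨ ∣p∪q∣≡∣p∣+∣q∣ (∅ {N}) _ (λ a _ → ∉⊥ a) ⟩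
  ∣ ∅ {N} ∣ + ∣ img (f ∘ suc) Y ∣    ≡⟨ cong₂ _+_ (∣⊥∣≡0 N) (∣img∣ (f ∘ suc) (inj-suc f inj) Y) ⟩
  ∣ Y ∣                          ∎
  where open ≡-Reasoning

img-⁅⁆ : ∀ (f : Fin n → Fin N) i → img f ⁅ i ⁆ ≡ ⁅ f i ⁆
img-⁅⁆ f i = ⊆-antisym ⊆⁅fi⁆ (λ h → subst (_∈ img f ⁅ i ⁆) (sym (x∈⁅y⁆⇒x≡y (f i) h)) (img⁺ f (x∈⁅x⁆ i)))
  where
  ⊆⁅fi⁆ : img f ⁅ i ⁆ ⊆ ⁅ f i ⁆
  ⊆⁅fi⁆ h with img⁻ f ⁅ i ⁆ h
  ... | j , j∈⁅i⁆ , refl = subst (λ l → f j ∈ ⁅ f l ⁆) (x∈⁅y⁆⇒x≡y i j∈⁅i⁆) (x∈⁅x⁆ (f j))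

img-∪ : ∀ (f : Fin n → Fin N) Y Z → img f (Y ∪ Z) ≡ img f Y ∪ img f Z
img-∪ f Y Z = ⊆-antisym ⊆∪ ∪⊆
  where
  ⊆∪ : img f (Y ∪ Z) ⊆ img f Y ∪ img f Z
  ⊆∪ h with img⁻ f (Y ∪ Z) h
  ... | i , i∈Y∪Z , refl with x∈p∪q⁻ Y Z i∈Y∪Z
  ...   | inj₁ a = p⊆p∪q _ (img⁺ f a)
  ...   | inj₂ b = q⊆p∪q _ _ (img⁺ f b)
  ∪⊆ : img f Y ∪ img f Z ⊆ img f (Y ∪ Z)
  ∪⊆ h with x∈p∪q⁻ (img f Y) (img f Z) h
  ... | inj₁ a = img-mono f (p⊆p∪q Z) a
  ... | inj₂ b = img-mono f (q⊆p∪q Y Z) b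

open RawMonad (¬¬-Monad {0ℓ}) using (pure; _>>=_)

¬¬-∀ : {P : Fin n → Set} → (∀ i → DoubleNegation (P i)) → DoubleNegation (∀ i → P i)
¬¬-∀ {zero}  h = pure λ ()
¬¬-∀ {suc n} h = do
  p₀ ← h zero
  ps ← ¬¬-∀ (h ∘ suc)
  pure λ { zero → p₀ ; (suc i) → ps i }

¬¬-→ : {A B : Set} → (A → DoubleNegation B) → DoubleNegation (A → B)
¬¬-→ f = do
  yes a ← ¬¬-excluded-middle
    where no ¬a → pure (⊥-elim ∘ ¬a)
  b ← f a
  pure λ _ → b

¬¬-decide : (P : Fin n → Set) → DoubleNegation (∀ i → Dec (P i))
¬¬-decide P = ¬¬-∀ (λ i → ¬¬-excluded-middle)

¬¬-minimal : {P : Subset n → Set} → DoubleNegation (Σ _ P) →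
             DoubleNegation (Σ _ λ D → P D × ∀ D′ → P D′ → ∣ D ∣ ≤ ∣ D′ ∣)
¬¬-minimal {P = P} ∃P = ∃P >>= λ (D , PD) → go D (<-wellFounded ∣ D ∣) PD
  where
  go : ∀ D → Acc _<_ ∣ D ∣ → P D → DoubleNegation (Σ _ λ D → P D × ∀ D′ → P D′ → ∣ D ∣ ≤ ∣ D′ ∣)
  go D (acc rs) PD = do
    no ¬smaller ← ¬¬-excluded-middle {A = Σ _ λ D′ → P D′ × ∣ D′ ∣ < ∣ D ∣}
      where yes (D′ , PD′ , D′<D) → go D′ (rs D′<D) PD′
    pure (D , PD , λ D′ PD′ → ≮⇒≥ λ D′<D → ¬smaller (D′ , PD′ , D′<D))

module MatroidRank (M : Matroid) where

  private
    variable
      A B : Subset (m M)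
      e : Fin (m M)

  infix 4 _∈cl_ _∉cl_
  _∈cl_ _∉cl_ : Fin (m M) → Subset (m M) → Set
  e ∈cl A = r M (A ∪ ⁅ e ⁆) ≤ r M A
  e ∉cl A = r M A < r M (A ∪ ⁅ e ⁆)

  r-mono⊆ : A ⊆ B → r M A ≤ r M B
  r-mono⊆ {A} {B} = r-mono M A B

  ∈⇒∈cl : e ∈ A → e ∈cl A
  ∈⇒∈cl e∈A = r-mono⊆ (∪⁅⁆⊆ ⊆-refl e∈A)

  ∉cl⇒∉ : e ∉cl A → e ∉ A
  ∉cl⇒∉ e∉clA e∈A = <-irrefl refl (<-≤-trans e∉clA (∈⇒∈cl e∈A))

  ∈cl-mono : A ⊆ B → e ∈cl A → e ∈cl B
  ∈cl-mono {A} {B} {e} A⊆B e∈clA = +-cancelʳ-≤ (r M A) _ _ (begin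
    r M (B ∪ ⁅ e ⁆) + r M A                              ≤⟨ +-mono-≤ (r-mono⊆ B∪e⊆) (r-mono⊆ A⊆∩) ⟩
    r M (B ∪ (A ∪ ⁅ e ⁆)) + r M (B ∩ (A ∪ ⁅ e ⁆))        ≤⟨ r-sub M B (A ∪ ⁅ e ⁆) ⟩
    r M B + r M (A ∪ ⁅ e ⁆)                              ≤⟨ +-monoʳ-≤ (r M B) e∈clA ⟩
    r M B + r M A                                        ∎)
    where
    open ≤-Reasoning
    B∪e⊆ : B ∪ ⁅ e ⁆ ⊆ B ∪ (A ∪ ⁅ e ⁆)
    B∪e⊆ h with x∈p∪q⁻ B ⁅ e ⁆ h
    ... | inj₁ b = p⊆p∪q _ b
    ... | inj₂ c = q⊆p∪q B _ (q⊆p∪q A _ c)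
    A⊆∩ : A ⊆ B ∩ (A ∪ ⁅ e ⁆)
    A⊆∩ a = x∈p∩q⁺ (A⊆B a , p⊆p∪q _ a)

  r-∪-∈cl : ∀ T → (∀ {t} → t ∈ T → t ∈cl A) → r M (A ∪ T) ≤ r M A
  r-∪-∈cl {A} T = go T (<-wellFounded ∣ T ∣)
    where
    go : ∀ T → Acc _<_ ∣ T ∣ → (∀ {t} → t ∈ T → t ∈cl A) → r M (A ∪ T) ≤ r M A
    go T (acc rs) T⊆clA with nonempty? T
    ... | no ¬ne = r-mono⊆ A∪T⊆A
      where
      A∪T⊆A : A ∪ T ⊆ A
      A∪T⊆A h with x∈p∪q⁻ A T h
      ... | inj₁ a = a
      ... | inj₂ t = ⊥-elim (¬ne (_ , t))
    ... | yes (t , t∈T) = begin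
      r M (A ∪ T)                  ≤⟨ r-mono⊆ A∪T⊆ ⟩
      r M ((A ∪ (T - t)) ∪ ⁅ t ⁆)  ≤⟨ ∈cl-mono (p⊆p∪q _) (T⊆clA t∈T) ⟩
      r M (A ∪ (T - t))            ≤⟨ go (T - t) (rs (x∈p⇒∣p-x∣<∣p∣ t∈T)) (λ h → T⊆clA (p─q⊆p T _ h)) ⟩
      r M A                        ∎
      where
      open ≤-Reasoning
      A∪T⊆ : A ∪ T ⊆ (A ∪ (T - t)) ∪ ⁅ t ⁆
      A∪T⊆ {x} h with x∈p∪q⁻ A T h | x ∈? ⁅ t ⁆
      ... | inj₁ a | _      = p⊆p∪q _ (p⊆p∪q _ a)
      ... | inj₂ _ | yes xt = q⊆p∪q _ _ xt
      ... | inj₂ b | no ¬xt = p⊆p∪q _ (q⊆p∪q A _ (x∈p∧x∉q⇒x∈p─q b ¬xt))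

  _∈cl?_ : ∀ e A → Dec (e ∈cl A)
  e ∈cl? A = r M (A ∪ ⁅ e ⁆) ≤? r M A

  closure : Subset (m M) → Subset (m M)
  closure A = decSubset (_∈cl? A)

  ⊆-closure : A ⊆ closure A
  ⊆-closure {A} e∈A = ∈decSubset⁺ (_∈cl? A) (∈⇒∈cl e∈A)

  r-closure : r M (closure A) ≡ r M A
  r-closure {A} = ≤-antisym
    (≤-trans (r-mono⊆ (q⊆p∪q A _)) (r-∪-∈cl (closure A) (∈decSubset⁻ (_∈cl? A))))
    (r-mono⊆ ⊆-closure)

  closure-isFlat : IsFlatIn ⊤ (r M) (closure A)
  closure-isFlat {A} = (λ _ → ∈⊤) , grows
    where
    grows : ∀ e → e ∈ ⊤ → e ∉ closure A → r M (closure A) < r M (closure A ∪ ⁅ e ⁆)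
    grows e _ e∉clA = subst (_< r M (closure A ∪ ⁅ e ⁆)) (sym r-closure)
      (<-≤-trans (≰⇒> (λ e∈clA → e∉clA (∈decSubset⁺ (_∈cl? A) e∈clA)))
                 (r-mono⊆ (∪⁅⁆⊆ (λ a → p⊆p∪q _ (⊆-closure a)) (q⊆p∪q _ _ (x∈⁅x⁆ e)))))

  r<r⊤⇒∉cl : r M A < r M ⊤ → DoubleNegation (Σ _ λ e → e ∉cl A)
  r<r⊤⇒∉cl {A} A<⊤ ¬∃ = <-irrefl refl (<-≤-trans A<⊤ (begin
    r M ⊤        ≤⟨ r-mono⊆ (q⊆p∪q A ⊤) ⟩
    r M (A ∪ ⊤)  ≤⟨ r-∪-∈cl ⊤ (λ {t} _ → ≮⇒≥ (λ t∉clA → ¬∃ (t , t∉clA))) ⟩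
    r M A        ∎))
    where open ≤-Reasoning

  r⊤≤r+r∁ : ∀ A → r M ⊤ ≤ r M A + r M (∁ A)
  r⊤≤r+r∁ A = begin
    r M ⊤                                ≤⟨ r-mono⊆ ⊤⊆A∪∁A ⟩
    r M (A ∪ ∁ A)                        ≤⟨ m≤m+n _ _ ⟩
    r M (A ∪ ∁ A) + r M (A ∩ ∁ A)        ≤⟨ r-sub M A (∁ A) ⟩
    r M A + r M (∁ A)                    ∎
    where
    open ≤-Reasoning
    ⊤⊆A∪∁A : ⊤ ⊆ A ∪ ∁ A
    ⊤⊆A∪∁A {x} _ with x ∈? A
    ... | yes a = p⊆p∪q _ a
    ... | no ¬a = q⊆p∪q A _ (x∉p⇒x∈∁p ¬a)

-- Circuits of a family of vectors over GF(2)

module F2Circuits {n k} (φ : Fin n → Vec Bool k) where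

  private
    variable
      A B D I K S Z : Subset n
      e w z : Fin n

  ∑ : Subset n → Vec Bool k
  ∑ = sumSub φ

  ZeroSum : Subset n → Set
  ZeroSum Z = ∑ Z ≡ zeroV

  Circuit : Subset n → Set
  Circuit D = Nonempty D × ZeroSum D × (∀ Z → Z ⊆ D → Nonempty Z → ZeroSum Z → ∣ D ∣ ≤ ∣ Z ∣)

  IndepF2-⊆ : IndepF2 φ B → A ⊆ B → IndepF2 φ A
  IndepF2-⊆ indB A⊆B Z Z⊆A = indB Z (A⊆B ∘ Z⊆A)

  ZeroSum-Δ : ∑ A ≡ ∑ B → ZeroSum (A Δ B)
  ZeroSum-Δ {A} {B} eq = trans (sum-Δ φ A B) (≡⇒⊕≡0 _ _ eq)

  ∑-split : ∀ D T → T ⊆ D → ∑ D ≡ ∑ (D ─ T) ⊕ ∑ T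
  ∑-split D T T⊆D = trans (cong ∑ D≡[D─T]ΔT) (sum-Δ φ (D ─ T) T)
    where
    D≡[D─T]ΔT : D ≡ (D ─ T) Δ T
    D≡[D─T]ΔT = ⊆-antisym to from
      where
      to : D ⊆ (D ─ T) Δ T
      to {x} h with x ∈? T
      ... | yes t = x∉p∧x∈q⇒x∈pΔq (D ─ T) T (λ c → proj₂ (x∈p─q⁻ D T c) t) t
      ... | no ¬t = x∈p∧x∉q⇒x∈pΔq (D ─ T) T (x∈p∧x∉q⇒x∈p─q h ¬t) ¬t
      from : (D ─ T) Δ T ⊆ D
      from h with x∈pΔq⁻ (D ─ T) T h
      ... | inj₁ (a , _) = p─q⊆p D T a
      ... | inj₂ (_ , b) = T⊆D b

  ZeroSum⇒∑─≡∑ : ZeroSum D → S ⊆ D → ∑ (D ─ S) ≡ ∑ S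
  ZeroSum⇒∑─≡∑ {D} {S} zD S⊆D = ⊕≡0⇒≡ _ _ (trans (sym (∑-split D S S⊆D)) zD)

  ZeroSum⇒∑-≡φ : ZeroSum Z → e ∈ Z → ∑ (Z - e) ≡ φ e
  ZeroSum⇒∑-≡φ {Z} {e} zZ e∈Z =
    trans (ZeroSum⇒∑─≡∑ zZ (λ h → subst (_∈ Z) (sym (x∈⁅y⁆⇒x≡y e h)) e∈Z)) (sum-⁅⁆ φ e)

  ∑≡φ⇒ZeroSum : e ∉ K → ∑ K ≡ φ e → ZeroSum (K ∪ ⁅ e ⁆)
  ∑≡φ⇒ZeroSum {e} {K} e∉K eq = begin
    ∑ (K ∪ ⁅ e ⁆)     ≡⟨ cong ∑ (disjoint⇒∪≡Δ K ⁅ e ⁆ (λ a b → e∉K (subst (_∈ K) (x∈⁅y⁆⇒x≡y e b) a))) ⟩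
    ∑ (K Δ ⁅ e ⁆)     ≡⟨ ZeroSum-Δ (trans eq (sym (sum-⁅⁆ φ e))) ⟩
    zeroV             ∎
    where open ≡-Reasoning

  circuit-─-indep : ∀ {x} → Circuit D → A ⊆ D → x ∈ D → x ∉ A → IndepF2 φ A
  circuit-─-indep {D} {A} {x} (_ , _ , minD) A⊆D x∈D x∉A Z Z⊆A neZ zZ =
    <-irrefl refl (≤-<-trans (≤-trans (minD Z (A⊆D ∘ Z⊆A) neZ zZ) (p⊆q⇒∣p∣≤∣q∣ Z⊆A))
                             (p⊂q⇒∣p∣<∣q∣ (A⊆D , x , x∈D , x∉A)))

  ∑-injective : IndepF2 φ I → A ⊆ I → B ⊆ I → ∑ A ≡ ∑ B → A ⊆ B
  ∑-injective {I} {A} {B} indI A⊆I B⊆I eq {x} x∈A with x ∈? B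
  ... | yes x∈B = x∈B
  ... | no  x∉B = ⊥-elim (indI (A Δ B) AΔB⊆I (x , x∈p∧x∉q⇒x∈pΔq A B x∈A x∉B) (ZeroSum-Δ eq))
    where
    AΔB⊆I : A Δ B ⊆ I
    AΔB⊆I h with x∈pΔq⁻ A B h
    ... | inj₁ (a , _) = A⊆I a
    ... | inj₂ (_ , b) = B⊆I b

  indep-∪⁅⁆-circuit : IndepF2 φ K → e ∉ K → ∑ K ≡ φ e → Circuit (K ∪ ⁅ e ⁆)
  indep-∪⁅⁆-circuit {K} {e} indK e∉K eq = (e , q⊆p∪q K _ (x∈⁅x⁆ e)) , ∑≡φ⇒ZeroSum e∉K eq , minimal
    where
    minimal : ∀ Z → Z ⊆ K ∪ ⁅ e ⁆ → Nonempty Z → ZeroSum Z → ∣ K ∪ ⁅ e ⁆ ∣ ≤ ∣ Z ∣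
    minimal Z Z⊆ neZ zZ with e ∈? Z
    ... | no  e∉Z = ⊥-elim (indK Z (⊆∪⁅⁆⇒⊆ Z⊆ e∉Z) neZ zZ)
    ... | yes e∈Z = p⊆q⇒∣p∣≤∣q∣ K∪e⊆Z
      where
      K⊆Z-e : K ⊆ Z - e
      K⊆Z-e = ∑-injective indK ⊆-refl (⊆∪⁅⁆⇒-⊆ Z⊆) (trans eq (sym (ZeroSum⇒∑-≡φ zZ e∈Z)))
      K∪e⊆Z : K ∪ ⁅ e ⁆ ⊆ Z
      K∪e⊆Z h with x∈p∪q⁻ K ⁅ e ⁆ h
      ... | inj₁ a = p─q⊆p Z _ (K⊆Z-e a)
      ... | inj₂ b = subst (_∈ Z) (sym (x∈⁅y⁆⇒x≡y e b)) e∈Z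

  ZeroSum⇒circuit : ∀ {x} → ZeroSum Z → x ∈ Z → DoubleNegation (Σ _ λ D → Circuit D × D ⊆ Z × x ∈ D)
  ZeroSum⇒circuit {Z} = go Z (<-wellFounded ∣ Z ∣)
    where
    go : ∀ {x} Z → Acc _<_ ∣ Z ∣ → ZeroSum Z → x ∈ Z → DoubleNegation (Σ _ λ D → Circuit D × D ⊆ Z × x ∈ D)
    go {x} Z (acc rs) zZ x∈Z = do
      no ¬smaller ← ¬¬-excluded-middle {A = Σ _ λ Z′ → Z′ ⊆ Z × x ∈ Z′ × ZeroSum Z′ × ∣ Z′ ∣ < ∣ Z ∣}
        where yes (Z′ , Z′⊆Z , x∈Z′ , zZ′ , Z′<Z) → ¬¬-map (widen Z′⊆Z) (go Z′ (rs Z′<Z) zZ′ x∈Z′)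
      pure (Z , ((x , x∈Z) , zZ , minimal ¬smaller) , (λ {_} h → h) , x∈Z)
      where
      widen : ∀ {Z′} → Z′ ⊆ Z → (Σ _ λ D → Circuit D × D ⊆ Z′ × x ∈ D) → Σ _ λ D → Circuit D × D ⊆ Z × x ∈ D
      widen Z′⊆Z (D , cD , D⊆Z′ , x∈D) = D , cD , ⊆-trans D⊆Z′ Z′⊆Z , x∈D
      minimal : ¬ (Σ _ λ Z′ → Z′ ⊆ Z × x ∈ Z′ × ZeroSum Z′ × ∣ Z′ ∣ < ∣ Z ∣) →
                ∀ Z′ → Z′ ⊆ Z → Nonempty Z′ → ZeroSum Z′ → ∣ Z ∣ ≤ ∣ Z′ ∣
      minimal ¬smaller Z′ Z′⊆Z (y , y∈Z′) zZ′ = ≮⇒≥ not-smaller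
        where
        not-smaller : ¬ (∣ Z′ ∣ < ∣ Z ∣)
        not-smaller Z′<Z with x ∈? Z′
        ... | yes x∈Z′ = ¬smaller (Z′ , Z′⊆Z , x∈Z′ , zZ′ , Z′<Z)
        ... | no  x∉Z′ = ¬smaller (Z Δ Z′ , ZΔZ′⊆Z , x∈p∧x∉q⇒x∈pΔq Z Z′ x∈Z x∉Z′ ,
                                   ZeroSum-Δ (trans zZ (sym zZ′)) ,
                                   p⊂q⇒∣p∣<∣q∣ (ZΔZ′⊆Z , y , Z′⊆Z y∈Z′ , x∈p∧x∈q⇒x∉pΔq Z Z′ (Z′⊆Z y∈Z′) y∈Z′))
          where
          ZΔZ′⊆Z : Z Δ Z′ ⊆ Z
          ZΔZ′⊆Z h with x∈pΔq⁻ Z Z′ h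
          ... | inj₁ (a , _) = a
          ... | inj₂ (_ , b) = Z′⊆Z b

  ZeroSum-in-Δ-meets : ∀ {D₁ D₂} → Circuit D₁ → w ∈ D₁ → w ∈ D₂ →
                       Nonempty Z → ZeroSum Z → Z ⊆ D₁ Δ D₂ → Nonempty (Z ∩ D₂)
  ZeroSum-in-Δ-meets {w} {Z} {D₁} {D₂} cD₁ w∈D₁ w∈D₂ neZ zZ Z⊆Δ with nonempty? (Z ∩ D₂)
  ... | yes meets = meets
  ... | no ¬meets = ⊥-elim (circuit-─-indep cD₁ Z⊆D₁ w∈D₁ w∉Z Z ⊆-refl neZ zZ)
    where
    w∉Z : w ∉ Z
    w∉Z = x∈p∧x∈q⇒x∉pΔq D₁ D₂ w∈D₁ w∈D₂ ∘ Z⊆Δ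
    Z⊆D₁ : Z ⊆ D₁
    Z⊆D₁ {y} h with x∈pΔq⁻ D₁ D₂ (Z⊆Δ h)
    ... | inj₁ (a , _) = a
    ... | inj₂ (_ , b) = ⊥-elim (¬meets (y , x∈p∩q⁺ (h , b)))

  CommonCircuit : Fin n → Fin n → Set
  CommonCircuit x z = Σ _ λ D → Circuit D × x ∈ D × z ∈ D

  circuit-transitive : ∀ {D₁ D₂ x} → Circuit D₁ → Circuit D₂ → w ∈ D₁ → w ∈ D₂ →
                       x ∈ D₁ → z ∈ D₂ → DoubleNegation (CommonCircuit x z)
  circuit-transitive {D₁ = D₁} {D₂} = go D₁ D₂ (<-wellFounded ∣ D₁ ∪ D₂ ∣)
    where
    go : ∀ {w x z} D₁ D₂ → Acc _<_ ∣ D₁ ∪ D₂ ∣ → Circuit D₁ → Circuit D₂ → w ∈ D₁ → w ∈ D₂ →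
         x ∈ D₁ → z ∈ D₂ → DoubleNegation (CommonCircuit x z)
    go {w} {x} {z} D₁ D₂ (acc rs) cD₁ cD₂ w∈D₁ w∈D₂ x∈D₁ z∈D₂ with z ∈? D₁ | x ∈? D₂
    ... | yes z∈D₁ | _        = pure (D₁ , cD₁ , x∈D₁ , z∈D₁)
    ... | no _     | yes x∈D₂ = pure (D₂ , cD₂ , x∈D₂ , z∈D₂)
    ... | no z∉D₁  | no x∉D₂  = ZeroSum⇒circuit zΔ₁₂ (x∈p∧x∉q⇒x∈pΔq D₁ D₂ x∈D₁ x∉D₂) >>= shrink
      where
      Δ₁₂ = D₁ Δ D₂
      zΔ₁₂ : ZeroSum Δ₁₂
      zΔ₁₂ = ZeroSum-Δ (trans (proj₁ (proj₂ cD₁)) (sym (proj₁ (proj₂ cD₂))))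
      shrink : (Σ _ λ D₃ → Circuit D₃ × D₃ ⊆ Δ₁₂ × x ∈ D₃) → DoubleNegation (CommonCircuit x z)
      shrink (D₃ , cD₃ , D₃⊆Δ₁₂ , x∈D₃) with z ∈? D₃
      ... | yes z∈D₃ = pure (D₃ , cD₃ , x∈D₃ , z∈D₃)
      ... | no  z∉D₃ = go D₃ D₂ (rs smaller) cD₃ cD₂ (proj₁ w′∈D₃∩D₂) (proj₂ w′∈D₃∩D₂) x∈D₃ z∈D₂
        where
        D₃-meets-D₂ = ZeroSum-in-Δ-meets cD₁ w∈D₁ w∈D₂ (proj₁ cD₃) (proj₁ (proj₂ cD₃)) D₃⊆Δ₁₂
        w′∈D₃∩D₂ = x∈p∩q⁻ D₃ D₂ (proj₂ D₃-meets-D₂)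
        Δ₁₂─D₃-meets-D₁ : Nonempty ((Δ₁₂ ─ D₃) ∩ D₁)
        Δ₁₂─D₃-meets-D₁ = ZeroSum-in-Δ-meets cD₂ w∈D₂ w∈D₁
          (z , x∈p∧x∉q⇒x∈p─q (x∉p∧x∈q⇒x∈pΔq D₁ D₂ z∉D₁ z∈D₂) z∉D₃)
          (trans (ZeroSum⇒∑─≡∑ zΔ₁₂ D₃⊆Δ₁₂) (proj₁ (proj₂ cD₃)))
          (subst (Δ₁₂ ─ D₃ ⊆_) (⊕-comm D₁ D₂) (p─q⊆p Δ₁₂ D₃))
        v = proj₁ Δ₁₂─D₃-meets-D₁
        v∈Δ₁₂─D₃ = proj₁ (x∈p∩q⁻ (Δ₁₂ ─ D₃) D₁ (proj₂ Δ₁₂─D₃-meets-D₁))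
        v∈D₁ = proj₂ (x∈p∩q⁻ (Δ₁₂ ─ D₃) D₁ (proj₂ Δ₁₂─D₃-meets-D₁))
        v∉D₂ : v ∉ D₂
        v∉D₂ v∈D₂ = x∈p∧x∈q⇒x∉pΔq D₁ D₂ v∈D₁ v∈D₂ (proj₁ (x∈p─q⁻ Δ₁₂ D₃ v∈Δ₁₂─D₃))
        D₃∪D₂⊆D₁∪D₂ : D₃ ∪ D₂ ⊆ D₁ ∪ D₂
        D₃∪D₂⊆D₁∪D₂ h with x∈p∪q⁻ D₃ D₂ h
        ... | inj₂ b = q⊆p∪q D₁ D₂ b
        ... | inj₁ a with x∈pΔq⁻ D₁ D₂ (D₃⊆Δ₁₂ a)
        ...   | inj₁ (c , _) = p⊆p∪q D₂ c
        ...   | inj₂ (_ , c) = q⊆p∪q D₁ D₂ c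
        smaller : ∣ D₃ ∪ D₂ ∣ < ∣ D₁ ∪ D₂ ∣
        smaller = p⊂q⇒∣p∣<∣q∣ (D₃∪D₂⊆D₁∪D₂ , v , p⊆p∪q D₂ v∈D₁ , ∉∪ (proj₂ (x∈p─q⁻ Δ₁₂ D₃ v∈Δ₁₂─D₃)) v∉D₂)

  ¬indep⇒ZeroSum : ¬ IndepF2 φ S → DoubleNegation (Σ _ λ Z → Z ⊆ S × Nonempty Z × ZeroSum Z)
  ¬indep⇒ZeroSum ¬indS ¬∃ = ¬indS (λ Z Z⊆S neZ zZ → ¬∃ (Z , Z⊆S , neZ , zZ))

  indep-extend : ∀ {x} → IndepF2 φ B → A ⊆ B → S ⊆ B → ∑ S ≡ φ e → x ∈ S → x ∉ A → IndepF2 φ (A ∪ ⁅ e ⁆)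
  indep-extend {B} {A} {S} {e} indB A⊆B S⊆B eq x∈S x∉A Z Z⊆ neZ zZ with e ∈? Z
  ... | no  e∉Z = indB Z (A⊆B ∘ ⊆∪⁅⁆⇒⊆ Z⊆ e∉Z) neZ zZ
  ... | yes e∈Z = x∉A (⊆∪⁅⁆⇒-⊆ Z⊆ (∑-injective indB S⊆B (A⊆B ∘ ⊆∪⁅⁆⇒-⊆ Z⊆) ∑S≡∑Z-e x∈S))
    where
    ∑S≡∑Z-e : ∑ S ≡ ∑ (Z - e)
    ∑S≡∑Z-e = trans eq (sym (ZeroSum⇒∑-≡φ zZ e∈Z))

-- Binary matroids and their contractions

module BinaryMatroid (M : Matroid) {k} (φ : Fin (m M) → Vec Bool k) (rk : ∀ X → IsRankF2 φ X (r M X)) where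

  open MatroidRank M
  open F2Circuits φ

  indep⇒∣∣≤r : ∀ {I T} → IndepF2 φ I → I ⊆ T → ∣ I ∣ ≤ r M T
  indep⇒∣∣≤r {I} {T} indI I⊆T = proj₂ (rk T) I I⊆T indI

  r-indep : ∀ {I} → IndepF2 φ I → r M I ≡ ∣ I ∣
  r-indep {I} indI = ≤-antisym (r-card M I) (indep⇒∣∣≤r indI ⊆-refl)

  ¬indep⇒r<∣∣ : ∀ {T} → ¬ IndepF2 φ T → r M T < ∣ T ∣
  ¬indep⇒r<∣∣ {T} ¬indT with proj₁ (rk T)
  ... | B , B⊆T , indB , ∣B∣≡r = ≤∧≢⇒< (r-card M T) r≢∣T∣
    where
    r≢∣T∣ : r M T ≢ ∣ T ∣
    r≢∣T∣ r≡∣T∣ = ¬indT (IndepF2-⊆ indB T⊆B)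
      where
      T⊆B : T ⊆ B
      T⊆B {x} x∈T with x ∈? B
      ... | yes x∈B = x∈B
      ... | no  x∉B = ⊥-elim (<-irrefl (trans ∣B∣≡r r≡∣T∣) (p⊂q⇒∣p∣<∣q∣ (B⊆T , x , x∈T , x∉B)))

  indep-∪⁅⁆-dep⇒∈cl : ∀ {A e} → IndepF2 φ A → ¬ IndepF2 φ (A ∪ ⁅ e ⁆) → e ∈cl A
  indep-∪⁅⁆-dep⇒∈cl {A} {e} indA ¬indAe with e ∈? A
  ... | yes e∈A = ∈⇒∈cl e∈A
  ... | no  e∉A = subst (r M (A ∪ ⁅ e ⁆) ≤_) (sym (r-indep indA))
                    (≤-pred (subst (r M (A ∪ ⁅ e ⁆) <_) (∣p∪⁅x⁆∣≡1+∣p∣ A e∉A) (¬indep⇒r<∣∣ ¬indAe)))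

  ∑⇒∈cl : ∀ {A e K} → IndepF2 φ K → K ⊆ A → ∑ K ≡ φ e → e ∈cl A
  ∑⇒∈cl {A} {e} {K} indK K⊆A eq with e ∈? K
  ... | yes e∈K = ∈⇒∈cl (K⊆A e∈K)
  ... | no  e∉K = ∈cl-mono K⊆A (indep-∪⁅⁆-dep⇒∈cl indK ¬indKe)
    where
    ¬indKe : ¬ IndepF2 φ (K ∪ ⁅ e ⁆)
    ¬indKe indKe = indKe (K ∪ ⁅ e ⁆) ⊆-refl (e , q⊆p∪q K _ (x∈⁅x⁆ e)) (∑≡φ⇒ZeroSum e∉K eq)

  ¬separator⇒circuit : ∀ A → r M A + r M (∁ A) ≢ r M ⊤ →
                       DoubleNegation (Σ _ λ D → Circuit D × Nonempty (D ∩ A) × Nonempty (D ∩ ∁ A))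
  ¬separator⇒circuit A r≢ with proj₁ (rk A) | proj₁ (rk (∁ A))
  ... | I , I⊆A , indI , ∣I∣≡rA | J , J⊆∁A , indJ , ∣J∣≡r∁A = do
    no ¬indI∪J ← ¬¬-excluded-middle
      where yes indI∪J → ⊥-elim (r≢ (≤-antisym (rA+r∁A≤r⊤ indI∪J) (r⊤≤r+r∁ A)))
    (Z , Z⊆I∪J , (x , x∈Z) , zZ) ← ¬indep⇒ZeroSum ¬indI∪J
    ¬¬-map (crossing Z⊆I∪J) (ZeroSum⇒circuit zZ x∈Z)
    where
    rA+r∁A≤r⊤ : IndepF2 φ (I ∪ J) → r M A + r M (∁ A) ≤ r M ⊤
    rA+r∁A≤r⊤ indI∪J = subst (_≤ r M ⊤)
      (trans (∣p∪q∣≡∣p∣+∣q∣ I J (λ a b → x∈∁p⇒x∉p (J⊆∁A b) (I⊆A a))) (cong₂ _+_ ∣I∣≡rA ∣J∣≡r∁A))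
      (indep⇒∣∣≤r indI∪J (λ _ → ∈⊤))
    crossing : ∀ {Z x} → Z ⊆ I ∪ J → (Σ _ λ D → Circuit D × D ⊆ Z × x ∈ D) → Σ _ λ D → Circuit D × Nonempty (D ∩ A) × Nonempty (D ∩ ∁ A)
    crossing Z⊆I∪J (D , cD , D⊆Z , _) with nonempty? (D ∩ I) | nonempty? (D ∩ J)
    ... | yes (a , a∈D∩I) | yes (b , b∈D∩J) = D , cD , (a , x∈p∩q⁺ (D∩I⊆D∩A a∈D∩I)) , (b , x∈p∩q⁺ (D∩J⊆D∩∁A b∈D∩J))
      where
      D∩I⊆D∩A : ∀ {y} → y ∈ D ∩ I → y ∈ D × y ∈ A
      D∩I⊆D∩A h = proj₁ (x∈p∩q⁻ D I h) , I⊆A (proj₂ (x∈p∩q⁻ D I h))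
      D∩J⊆D∩∁A : ∀ {y} → y ∈ D ∩ J → y ∈ D × y ∈ ∁ A
      D∩J⊆D∩∁A h = proj₁ (x∈p∩q⁻ D J h) , J⊆∁A (proj₂ (x∈p∩q⁻ D J h))
    ... | no D∌I | _ = ⊥-elim (indJ D D⊆J (proj₁ cD) (proj₁ (proj₂ cD)))
      where
      D⊆J : D ⊆ J
      D⊆J {y} h with x∈p∪q⁻ I J (Z⊆I∪J (D⊆Z h))
      ... | inj₁ a = ⊥-elim (D∌I (y , x∈p∩q⁺ (h , a)))
      ... | inj₂ b = b
    ... | _ | no D∌J = ⊥-elim (indI D D⊆I (proj₁ cD) (proj₁ (proj₂ cD)))
      where
      D⊆I : D ⊆ I
      D⊆I {y} h with x∈p∪q⁻ I J (Z⊆I∪J (D⊆Z h))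
      ... | inj₁ a = a
      ... | inj₂ b = ⊥-elim (D∌J (y , x∈p∩q⁺ (h , b)))

  circuit-∉cl : ∀ {D p} Y → Circuit D → p ∈ D → p ∉cl Y →
                DoubleNegation (Σ _ λ p′ → p′ ∈ D × p′ ≢ p × p′ ∉cl Y)
  circuit-∉cl {D} {p} Y cD p∈D p∉clY ¬∃ = <-irrefl refl (<-≤-trans p∉clY (begin
    r M (Y ∪ ⁅ p ⁆)          ≤⟨ r-mono⊆ (∪⁅⁆⊆ (p⊆p∪q _ ∘ p⊆p∪q _) (q⊆p∪q _ _ (x∈⁅x⁆ p))) ⟩
    r M ((Y ∪ K) ∪ ⁅ p ⁆)    ≤⟨ ∑⇒∈cl indK (q⊆p∪q Y K) (ZeroSum⇒∑-≡φ (proj₁ (proj₂ cD)) p∈D) ⟩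
    r M (Y ∪ K)              ≤⟨ r-∪-∈cl K K⊆clY ⟩
    r M Y                    ∎))
    where
    open ≤-Reasoning
    K = D - p
    indK : IndepF2 φ K
    indK = circuit-─-indep cD (p─q⊆p D _) p∈D (λ h → proj₂ (x∈p─q⁻ D _ h) (x∈⁅x⁆ p))
    K⊆clY : ∀ {t} → t ∈ K → t ∈cl Y
    K⊆clY {t} h with x∈p─q⁻ D _ h
    ... | t∈D , t∉⁅p⁆ = ≮⇒≥ (λ t∉clY → ¬∃ (t , t∈D , (λ t≡p → t∉⁅p⁆ (subst (_∈ ⁅ p ⁆) (sym t≡p) (x∈⁅x⁆ p))) , t∉clY))

  r-spanned : ∀ {A B} → IndepF2 φ A → A ⊆ B → (∀ {t} → t ∈ B → t ∈cl A) → r M B ≡ ∣ A ∣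
  r-spanned {A} {B} indA A⊆B B⊆clA = trans (≤-antisym r≤ (r-mono⊆ A⊆B)) (r-indep indA)
    where
    r≤ : r M B ≤ r M A
    r≤ = ≤-trans (r-mono⊆ (q⊆p∪q A B)) (r-∪-∈cl B B⊆clA)

  module Contraction (C : Subset (m M)) (indC : IndepF2 φ C) where

    ρ : Subset (m M) → ℕ
    ρ = contractRank (r M) C

    record Realisation {n k′} (ψ : Fin n → Vec Bool k′) : Set where
      field
        f         : Fin n → Fin (m M)
        injective : Injective f
        avoids    : ∀ i → f i ∉ C
        indep⇒    : ∀ Y → IndepF2 ψ Y → IndepF2 φ (C ∪ img f Y)
        indep⇐    : ∀ Y → IndepF2 φ (C ∪ img f Y) → IndepF2 ψ Y

    module _ {n k′} {ψ : Fin n → Vec Bool k′} (real : Realisation ψ) where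
      open Realisation real

      ∣C∪img∣ : ∀ Y → ∣ C ∪ img f Y ∣ ≡ ∣ C ∣ + ∣ Y ∣
      ∣C∪img∣ Y = trans (∣p∪q∣≡∣p∣+∣q∣ C (img f Y) C∌img) (cong (∣ C ∣ +_) (∣img∣ f injective Y))
        where
        C∌img : ∀ {x} → x ∈ C → x ∉ img f Y
        C∌img x∈C h with img⁻ f Y h
        ... | i , _ , refl = avoids i x∈C

      C∪img-spans : ∀ {X Y} → IndepF2 ψ Y → (∀ {x} → x ∈ X → x ∉ Y → ¬ IndepF2 ψ (Y ∪ ⁅ x ⁆)) →
                    ∀ {t} → t ∈ img f X ∪ C → t ∈cl (C ∪ img f Y)
      C∪img-spans {X} {Y} indY maximal {t} h with t ∈? C ∪ img f Y | x∈p∪q⁻ (img f X) C h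
      ... | yes t∈A | _      = ∈⇒∈cl t∈A
      ... | no  t∉A | inj₂ c = ⊥-elim (t∉A (p⊆p∪q _ c))
      ... | no  t∉A | inj₁ b with img⁻ f X b
      ...   | x , x∈X , refl = indep-∪⁅⁆-dep⇒∈cl (indep⇒ Y indY) ¬indep
        where
        C∪img≡ : C ∪ img f (Y ∪ ⁅ x ⁆) ≡ (C ∪ img f Y) ∪ ⁅ f x ⁆
        C∪img≡ = trans (cong (C ∪_) (trans (img-∪ f Y ⁅ x ⁆) (cong (img f Y ∪_) (img-⁅⁆ f x))))
                       (sym (∪-assoc C (img f Y) ⁅ f x ⁆))
        ¬indep : ¬ IndepF2 φ ((C ∪ img f Y) ∪ ⁅ f x ⁆)
        ¬indep ind = maximal x∈X (t∉A ∘ q⊆p∪q C _ ∘ img⁺ f) (indep⇐ (Y ∪ ⁅ x ⁆) (IndepF2-⊆ ind (⊆-reflexive C∪img≡)))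

      ρ-img : ∀ {rψ : Subset n → ℕ} → (∀ X → IsRankF2 ψ X (rψ X)) → ∀ X → ρ (img f X) ≡ rψ X
      ρ-img {rψ} rkψ X with proj₁ (rkψ X)
      ... | Y , Y⊆X , indY , ∣Y∣≡rψ = begin
        r M (img f X ∪ C) ∸ r M C     ≡⟨ cong₂ _∸_ (r-spanned (indep⇒ Y indY) C∪img⊆ (C∪img-spans indY maximal))
                                                   (r-indep indC) ⟩
        ∣ C ∪ img f Y ∣ ∸ ∣ C ∣       ≡⟨ cong (_∸ ∣ C ∣) (∣C∪img∣ Y) ⟩
        ∣ C ∣ + ∣ Y ∣ ∸ ∣ C ∣         ≡⟨ m+n∸m≡n ∣ C ∣ ∣ Y ∣ ⟩
        ∣ Y ∣                         ≡⟨ ∣Y∣≡rψ ⟩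
        rψ X                          ∎
        where
        open ≡-Reasoning
        C∪img⊆ : C ∪ img f Y ⊆ img f X ∪ C
        C∪img⊆ h with x∈p∪q⁻ C (img f Y) h
        ... | inj₁ c = q⊆p∪q _ C c
        ... | inj₂ a = p⊆p∪q C (img-mono f Y⊆X a)
        maximal : ∀ {x} → x ∈ X → x ∉ Y → ¬ IndepF2 ψ (Y ∪ ⁅ x ⁆)
        maximal {x} x∈X x∉Y ind = <-irrefl refl (<-≤-trans
          (subst (rψ X <_) (sym (∣p∪⁅x⁆∣≡1+∣p∣ Y x∉Y)) (≤-reflexive (cong suc (sym ∣Y∣≡rψ))))
          (proj₂ (rkψ X) _ (∪⁅⁆⊆ Y⊆X x∈X) ind))

    ∈cl⇒ρ≡0 : ∀ {e} → e ∈cl C → ρ ⁅ e ⁆ ≡ 0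
    ∈cl⇒ρ≡0 {e} e∈clC = m≤n⇒m∸n≡0 (≤-trans (r-mono⊆ (⊆-reflexive (∪-comm ⁅ e ⁆ C))) e∈clC)

    ρ-parallel : ∀ {s e K} → s ∉ C → IndepF2 φ (C ∪ ⁅ s ⁆) → K ⊆ C ∪ ⁅ s ⁆ → ∑ K ≡ φ e → ρ (⁅ e ⁆ ∪ ⁅ s ⁆) ≡ 1
    ρ-parallel {s} {e} {K} s∉C indCs K⊆ eq = begin
      r M ((⁅ e ⁆ ∪ ⁅ s ⁆) ∪ C) ∸ r M C   ≡⟨ cong₂ _∸_ (r-spanned indCs Cs⊆ spans) (r-indep indC) ⟩
      ∣ C ∪ ⁅ s ⁆ ∣ ∸ ∣ C ∣               ≡⟨ cong (_∸ ∣ C ∣) (∣p∪⁅x⁆∣≡1+∣p∣ C s∉C) ⟩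
      suc ∣ C ∣ ∸ ∣ C ∣                   ≡⟨ m+n∸n≡m 1 ∣ C ∣ ⟩
      1                                   ∎
      where
      open ≡-Reasoning
      Cs⊆ : C ∪ ⁅ s ⁆ ⊆ (⁅ e ⁆ ∪ ⁅ s ⁆) ∪ C
      Cs⊆ = ∪⁅⁆⊆ (q⊆p∪q _ C) (p⊆p∪q C (q⊆p∪q ⁅ e ⁆ _ (x∈⁅x⁆ s)))
      spans : ∀ {t} → t ∈ (⁅ e ⁆ ∪ ⁅ s ⁆) ∪ C → t ∈cl (C ∪ ⁅ s ⁆)
      spans {t} h with x∈p∪q⁻ (⁅ e ⁆ ∪ ⁅ s ⁆) C h
      ... | inj₂ c = ∈⇒∈cl (p⊆p∪q _ c)
      ... | inj₁ d with x∈p∪q⁻ ⁅ e ⁆ ⁅ s ⁆ d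
      ...   | inj₂ b = ∈⇒∈cl (q⊆p∪q C _ b)
      ...   | inj₁ a = subst (_∈cl (C ∪ ⁅ s ⁆)) (sym (x∈⁅y⁆⇒x≡y e a)) (∑⇒∈cl (IndepF2-⊆ indCs K⊆) K⊆ eq)

    Covers : ∀ {n} → Subset (m M) → (Fin n → Fin (m M)) → Set
    Covers F f = ∀ e → e ∈ F → ρ ⁅ e ⁆ ≡ 1 → Σ _ λ g → g ∈ img f ⊤ × ρ (⁅ e ⁆ ∪ ⁅ g ⁆) ≡ 1

    realisation⇒inducedMinor : ∀ {F n k′} {ψ : Fin n → Vec Bool k′} {rψ : Subset n → ℕ} →
      IsFlatIn ⊤ (r M) F → C ⊆ F →
      (∀ X → IsRankF2 ψ X (rψ X)) → (∀ i → rψ ⁅ i ⁆ ≡ 1) → (∀ i j → i ≢ j → rψ (⁅ i ⁆ ∪ ⁅ j ⁆) ≡ 2) →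
      (real : Realisation ψ) → (∀ i → Realisation.f real i ∈ F) → Covers F (Realisation.f real) →
      HasInducedMinor M ψ
    realisation⇒inducedMinor {F} {ψ = ψ} {rψ} F-flat C⊆F rkψ rψ-⁅⁆ rψ-pair real f∈F covers =
      img f ⊤ , ρ , contract C (img f ⊤) (restrict F start F-flat) C⊆F simplification ,
      f , injective , (λ _ h → onto h) , f∈img⊤ f , rank
      where
      open Realisation real
      rank : ∀ X → IsRankF2 ψ X (ρ (img f X))
      rank X = subst (IsRankF2 ψ X) (sym (ρ-img real rkψ X)) (rkψ X)
      onto : ∀ {e} → e ∈ img f ⊤ → Σ _ λ i → f i ≡ e
      onto h with img⁻ f ⊤ h
      ... | i , _ , fi≡e = i , fi≡e
      simplification : IsSimplification F ρ (img f ⊤)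
      simplification = img⊆F , ρ-single , ρ-pair , covers
        where
        img⊆F : img f ⊤ ⊆ F
        img⊆F h with img⁻ f ⊤ h
        ... | i , _ , refl = f∈F i
        ρ-single : ∀ e → e ∈ img f ⊤ → ρ ⁅ e ⁆ ≡ 1
        ρ-single _ h with img⁻ f ⊤ h
        ... | i , _ , refl = trans (cong ρ (sym (img-⁅⁆ f i))) (trans (ρ-img real rkψ ⁅ i ⁆) (rψ-⁅⁆ i))
        ρ-pair : ∀ e e′ → e ∈ img f ⊤ → e′ ∈ img f ⊤ → e ≢ e′ → ρ (⁅ e ⁆ ∪ ⁅ e′ ⁆) ≡ 2
        ρ-pair _ _ h h′ e≢e′ with img⁻ f ⊤ h | img⁻ f ⊤ h′
        ... | i , _ , refl | j , _ , refl = begin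
          ρ (⁅ f i ⁆ ∪ ⁅ f j ⁆)          ≡⟨ cong ρ (cong₂ _∪_ (img-⁅⁆ f i) (img-⁅⁆ f j)) ⟨
          ρ (img f ⁅ i ⁆ ∪ img f ⁅ j ⁆)  ≡⟨ cong ρ (img-∪ f ⁅ i ⁆ ⁅ j ⁆) ⟨
          ρ (img f (⁅ i ⁆ ∪ ⁅ j ⁆))      ≡⟨ ρ-img real rkψ _ ⟩
          rψ (⁅ i ⁆ ∪ ⁅ j ⁆)             ≡⟨ rψ-pair i j (e≢e′ ∘ cong f) ⟩
          2                              ∎
          where open ≡-Reasoning

-- The matroids M(C₄) and M(K₄\e)

ZeroSum? : ∀ {n k} (ψ : Fin n → Vec Bool k) Z → Dec (sumSub ψ Z ≡ zeroV)
ZeroSum? ψ Z = ≡-dec _≟ᵇ_ (sumSub ψ Z) zeroV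

IndepF2? : ∀ {n k} (ψ : Fin n → Vec Bool k) Y → Dec (IndepF2 ψ Y)
IndepF2? ψ Y = map′ to from (¬? (anySubset? (λ Z → (Z ⊆? Y) ×-dec nonempty? Z ×-dec ZeroSum? ψ Z)))
  where
  Dependency = Σ _ λ Z → Z ⊆ Y × Nonempty Z × sumSub ψ Z ≡ zeroV
  to : ¬ Dependency → IndepF2 ψ Y
  to ¬dep Z Z⊆Y neZ zZ = ¬dep (Z , Z⊆Y , neZ , zZ)
  from : IndepF2 ψ Y → ¬ Dependency
  from indY (Z , Z⊆Y , neZ , zZ) = indY Z Z⊆Y neZ zZ

IsRankF2? : ∀ {n k} (ψ : Fin n → Vec Bool k) X r → Dec (IsRankF2 ψ X r)
IsRankF2? ψ X r = anySubset? (λ Y → (Y ⊆? X) ×-dec IndepF2? ψ Y ×-dec (∣ Y ∣ ≟ⁿ r)) ×-dec bounded?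
  where
  Exceeds = Σ _ λ Y → Y ⊆ X × IndepF2 ψ Y × ¬ (∣ Y ∣ ≤ r)
  Bounded = ∀ Y → Y ⊆ X → IndepF2 ψ Y → ∣ Y ∣ ≤ r
  to : ¬ Exceeds → Bounded
  to ¬exc Y Y⊆X indY = ≮⇒≥ λ r<∣Y∣ → ¬exc (Y , Y⊆X , indY , <⇒≱ r<∣Y∣)
  from : Bounded → ¬ Exceeds
  from bounded (Y , Y⊆X , indY , ∣Y∣≰r) = ∣Y∣≰r (bounded Y Y⊆X indY)
  bounded? : Dec Bounded
  bounded? = map′ to from (¬? (anySubset? (λ Y → (Y ⊆? X) ×-dec IndepF2? ψ Y ×-dec ¬? (∣ Y ∣ ≤? r))))

∀-Subset? : ∀ {n} {P : Subset n → Set} → (∀ X → Dec (P X)) → Dec (∀ X → P X)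
∀-Subset? {zero}  {P} P? = map′ (λ p → λ { [] → p }) (λ all → all []) (P? [])
∀-Subset? {suc n} {P} P? = map′ to from (∀-Subset? (λ X → P? (true ∷ X)) ×-dec ∀-Subset? (λ X → P? (false ∷ X)))
  where
  to : (∀ X → P (true ∷ X)) × (∀ X → P (false ∷ X)) → ∀ X → P X
  to (p₁ , p₀) (true  ∷ X) = p₁ X
  to (p₁ , p₀) (false ∷ X) = p₀ X
  from : (∀ X → P X) → (∀ X → P (true ∷ X)) × (∀ X → P (false ∷ X))
  from all = (λ X → all (true ∷ X)) , (λ X → all (false ∷ X))

subsets : ∀ n → List (Subset n)
subsets zero    = [] ∷ []
subsets (suc n) = map (true ∷_) (subsets n) ++ map (false ∷_) (subsets n)

-- Only shown to be the rank, by evaluation, for MC4 and MK4e.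
rankF2 : ∀ {n k} (ψ : Fin n → Vec Bool k) → Subset n → ℕ
rankF2 {n} ψ X = foldr _⊔_ 0 (map size-if-indep (subsets n))
  where
  size-if-indep : Subset n → ℕ
  size-if-indep Y = if does (Y ⊆? X) ∧ does (IndepF2? ψ Y) then ∣ Y ∣ else 0

rankF2-MC4 : ∀ X → IsRankF2 MC4 X (rankF2 MC4 X)
rankF2-MC4 = from-yes (∀-Subset? λ X → IsRankF2? MC4 X (rankF2 MC4 X))

rankF2-MK4e : ∀ X → IsRankF2 MK4e X (rankF2 MK4e X)
rankF2-MK4e = from-yes (∀-Subset? λ X → IsRankF2? MK4e X (rankF2 MK4e X))

rankF2-MC4-⁅⁆ : ∀ i → rankF2 MC4 ⁅ i ⁆ ≡ 1
rankF2-MC4-⁅⁆ = from-yes (all? λ i → rankF2 MC4 ⁅ i ⁆ ≟ⁿ 1)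

rankF2-MC4-pair : ∀ i j → i ≢ j → rankF2 MC4 (⁅ i ⁆ ∪ ⁅ j ⁆) ≡ 2
rankF2-MC4-pair = from-yes (all? λ i → all? λ j → ¬? (i ≟ᶠ j) →-dec (rankF2 MC4 (⁅ i ⁆ ∪ ⁅ j ⁆) ≟ⁿ 2))

rankF2-MK4e-⁅⁆ : ∀ i → rankF2 MK4e ⁅ i ⁆ ≡ 1
rankF2-MK4e-⁅⁆ = from-yes (all? λ i → rankF2 MK4e ⁅ i ⁆ ≟ⁿ 1)

rankF2-MK4e-pair : ∀ i j → i ≢ j → rankF2 MK4e (⁅ i ⁆ ∪ ⁅ j ⁆) ≡ 2
rankF2-MK4e-pair = from-yes (all? λ i → all? λ j → ¬? (i ≟ᶠ j) →-dec (rankF2 MK4e (⁅ i ⁆ ∪ ⁅ j ⁆) ≟ⁿ 2))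

-- The edges 0, …, 4 of MK4e are 01, 02, 03, 12, 13; its circuits are {0,1,3}, {0,2,4}, {1,2,3,4}.
isIndep-MC4 : Subset 4 → Bool
isIndep-MC4 (y₀ ∷ y₁ ∷ y₂ ∷ y₃ ∷ []) = not (y₀ ∧ y₁ ∧ y₂ ∧ y₃)

isIndep-MK4e : Subset 5 → Bool
isIndep-MK4e (y₀ ∷ y₁ ∷ y₂ ∷ y₃ ∷ y₄ ∷ []) = not ((y₀ ∧ y₁ ∧ y₃) ∨ (y₀ ∧ y₂ ∧ y₄) ∨ (y₁ ∧ y₂ ∧ y₃ ∧ y₄))

IndepF2-MC4 : ∀ Y → (IndepF2 MC4 Y → T (isIndep-MC4 Y)) × (T (isIndep-MC4 Y) → IndepF2 MC4 Y)
IndepF2-MC4 = from-yes (∀-Subset? λ Y → (IndepF2? MC4 Y →-dec T? (isIndep-MC4 Y)) ×-dec (T? (isIndep-MC4 Y) →-dec IndepF2? MC4 Y))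

IndepF2-MK4e : ∀ Y → (IndepF2 MK4e Y → T (isIndep-MK4e Y)) × (T (isIndep-MK4e Y) → IndepF2 MK4e Y)
IndepF2-MK4e = from-yes (∀-Subset? λ Y → (IndepF2? MK4e Y →-dec T? (isIndep-MK4e Y)) ×-dec (T? (isIndep-MK4e Y) →-dec IndepF2? MK4e Y))

-- Crossing circuits of a separation

module CrossingCircuits (M : Matroid) {k} (φ : Fin (m M) → Vec Bool k) (rk : ∀ X → IsRankF2 φ X (r M X))
                        (X : Subset (m M)) where

  open MatroidRank M
  open F2Circuits φ
  open BinaryMatroid M φ rk

  Crossing : Subset (m M) → Set
  Crossing D = Circuit D × (Σ _ λ a → a ∈ D × a ∉cl ∁ X) × (Σ _ λ b → b ∈ D × b ∉cl X)

  ∉cl∁≢∉cl : ∀ {a b} → a ∉cl ∁ X → b ∉cl X → a ≢ b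
  ∉cl∁≢∉cl a∉cl b∉cl refl = ∉cl⇒∉ a∉cl (x∉p⇒x∈∁p (∉cl⇒∉ b∉cl))

  crossing-exists : ¬ Disconnected M → r M (∁ X) < r M ⊤ → r M X < r M ⊤ → DoubleNegation (Σ _ Crossing)
  crossing-exists connected ∁X<⊤ X<⊤ = do
    (p , p∉cl) ← r<r⊤⇒∉cl ∁X<⊤
    (q , q∉cl) ← r<r⊤⇒∉cl X<⊤
    linked? ← ¬¬-decide (Linked p)
    component p∉cl q∉cl linked?
    where
    Linked : Fin (m M) → Fin (m M) → Set
    Linked p g = g ≡ p ⊎ CommonCircuit p g

    component : ∀ {p q} → p ∉cl ∁ X → q ∉cl X → (∀ g → Dec (Linked p g)) → DoubleNegation (Σ _ Crossing)
    component {p} {q} p∉cl q∉cl linked? with linked? q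
    ... | yes (inj₁ q≡p) = ⊥-elim (∉cl∁≢∉cl p∉cl q∉cl (sym q≡p))
    ... | yes (inj₂ (D , cD , p∈D , q∈D)) = pure (D , cD , (p , p∈D , p∉cl) , (q , q∈D , q∉cl))
    ... | no ¬linked = do
      no ¬sep ← ¬¬-excluded-middle
        where yes sep → ⊥-elim (connected (A , (p , p∈A) , (q , x∉p⇒x∈∁p (¬linked ∘ ∈decSubset⁻ linked?)) , sep))
      (D , cD , (a , a∈D∩A) , (b , b∈D∩∁A)) ← ¬separator⇒circuit A ¬sep
      ¬¬-map (⊥-elim ∘ x∈∁p⇒x∉p (proj₂ (x∈p∩q⁻ D _ b∈D∩∁A)) ∘ ∈decSubset⁺ linked?)
             (linked-via cD (proj₁ (x∈p∩q⁻ D A a∈D∩A)) (proj₁ (x∈p∩q⁻ D _ b∈D∩∁A))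
                        (∈decSubset⁻ linked? (proj₂ (x∈p∩q⁻ D A a∈D∩A))))
      where
      A = decSubset linked?
      p∈A : p ∈ A
      p∈A = ∈decSubset⁺ linked? (inj₁ refl)
      linked-via : ∀ {D a b} → Circuit D → a ∈ D → b ∈ D → Linked p a → DoubleNegation (Linked p b)
      linked-via cD a∈D b∈D (inj₁ refl) = pure (inj₂ (_ , cD , a∈D , b∈D))
      linked-via cD a∈D b∈D (inj₂ (D₀ , cD₀ , p∈D₀ , a∈D₀)) =
        ¬¬-map inj₂ (circuit-transitive cD₀ cD a∈D₀ a∈D p∈D₀ b∈D)

-- A minimal crossing circuit

∷ᶠ-injective : ∀ {n N} {x : Fin N} {f : Fin n → Fin N} → (∀ i → f i ≢ x) → Injective f → Injective (x ∷ᶠ f)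
∷ᶠ-injective fresh inj zero    zero    _  = refl
∷ᶠ-injective fresh inj zero    (suc j) eq = ⊥-elim (fresh j (sym eq))
∷ᶠ-injective fresh inj (suc i) zero    eq = ⊥-elim (fresh i eq)
∷ᶠ-injective fresh inj (suc i) (suc j) eq = cong suc (inj i j eq)

d≤2-if-split-in-halves : ∀ {d t u} → t + u ≡ d → d ≤ suc t → d ≤ suc u → d ≤ 2
d≤2-if-split-in-halves {d} {t} {u} t+u≡d d≤1+t d≤1+u = +-cancelʳ-≤ d d 2 (begin
  d + d              ≤⟨ +-mono-≤ d≤1+t d≤1+u ⟩
  suc t + suc u      ≡⟨ cong suc (+-suc t u) ⟩
  2 + (t + u)        ≡⟨ cong (2 +_) t+u≡d ⟩
  2 + d              ∎)
  where
  open ≤-Reasoning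

module MinimalCrossing (M : Matroid) {k} (φ : Fin (m M) → Vec Bool k) (rk : ∀ X → IsRankF2 φ X (r M X))
  (X : Subset (m M)) (D : Subset (m M))
  (crossingD : CrossingCircuits.Crossing M φ rk X D)
  (minimal : ∀ D′ → CrossingCircuits.Crossing M φ rk X D′ → ∣ D ∣ ≤ ∣ D′ ∣) where

  open MatroidRank M
  open F2Circuits φ
  open BinaryMatroid M φ rk
  open CrossingCircuits M φ rk X

  cD : Circuit D
  cD = proj₁ crossingD

  -- Otherwise T ∪ ⁅ e ⁆ and (D ─ T) ∪ ⁅ e ⁆ are crossing circuits, one of them smaller than D.
  no-balanced-split : ∀ {T e a b a′ b′} → T ⊆ D → ∑ T ≡ φ e → e ∉ D →
    a ∈ T → a ∉cl ∁ X → b ∈ T → b ∉cl X → a′ ∈ D → a′ ∉ T → a′ ∉cl ∁ X → b′ ∈ D → b′ ∉ T → b′ ∉cl X → ⊥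
  no-balanced-split {T} {e} {a} {b} {a′} {b′} T⊆D eq e∉D a∈T a∉cl b∈T b∉cl a′∈D a′∉T a′∉cl b′∈D b′∉T b′∉cl =
    <-irrefl refl (<-≤-trans three≤∣D∣ (d≤2-if-split-in-halves (∣q∣+∣p─q∣≡∣p∣ D T T⊆D) D≤T D≤D─T))
    where
    e∉T : e ∉ T
    e∉T = e∉D ∘ T⊆D
    e∉D─T : e ∉ D ─ T
    e∉D─T = e∉D ∘ p─q⊆p D T
    a′∈D─T = x∈p∧x∉q⇒x∈p─q a′∈D a′∉T
    b′∈D─T = x∈p∧x∉q⇒x∈p─q b′∈D b′∉T
    circuit-T : Circuit (T ∪ ⁅ e ⁆)
    circuit-T = indep-∪⁅⁆-circuit (circuit-─-indep cD T⊆D a′∈D a′∉T) e∉T eq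
    circuit-D─T : Circuit ((D ─ T) ∪ ⁅ e ⁆)
    circuit-D─T = indep-∪⁅⁆-circuit (circuit-─-indep cD (p─q⊆p D T) (T⊆D a∈T) (λ h → proj₂ (x∈p─q⁻ D T h) a∈T))
                    e∉D─T (trans (ZeroSum⇒∑─≡∑ (proj₁ (proj₂ cD)) T⊆D) eq)
    D≤T : ∣ D ∣ ≤ suc ∣ T ∣
    D≤T = subst (∣ D ∣ ≤_) (∣p∪⁅x⁆∣≡1+∣p∣ T e∉T)
      (minimal _ (circuit-T , (a , p⊆p∪q _ a∈T , a∉cl) , (b , p⊆p∪q _ b∈T , b∉cl)))
    D≤D─T : ∣ D ∣ ≤ suc ∣ D ─ T ∣
    D≤D─T = subst (∣ D ∣ ≤_) (∣p∪⁅x⁆∣≡1+∣p∣ (D ─ T) e∉D─T)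
      (minimal _ (circuit-D─T , (a′ , p⊆p∪q _ a′∈D─T , a′∉cl) , (b′ , p⊆p∪q _ b′∈D─T , b′∉cl)))
    three≤∣D∣ : 3 ≤ ∣ D ∣
    three≤∣D∣ = 3≤∣p∣ (T⊆D a∈T) (T⊆D b∈T) a′∈D (∉cl∁≢∉cl a∉cl b∉cl)
                  (λ a′≡a → a′∉T (subst (_∈ T) (sym a′≡a) a∈T)) (λ a′≡b → a′∉T (subst (_∈ T) (sym a′≡b) b∈T))

  module FourElements (a₁ a₂ b₁ b₂ : Fin (m M))
    (a₁∈D : a₁ ∈ D) (a₂∈D : a₂ ∈ D) (b₁∈D : b₁ ∈ D) (b₂∈D : b₂ ∈ D)
    (a₁∉cl : a₁ ∉cl ∁ X) (a₂∉cl : a₂ ∉cl ∁ X) (b₁∉cl : b₁ ∉cl X) (b₂∉cl : b₂ ∉cl X)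
    (a₂≢a₁ : a₂ ≢ a₁) (b₂≢b₁ : b₂ ≢ b₁) where

    quad : Fin 4 → Fin (m M)
    quad = a₁ ∷ᶠ b₁ ∷ᶠ a₂ ∷ᶠ b₂ ∷ᶠ []ᶠ

    quad-injective : Injective quad
    quad-injective = ∷ᶠ-injective ≢a₁ (∷ᶠ-injective ≢b₁ (∷ᶠ-injective ≢a₂ (∷ᶠ-injective (λ ()) (λ ()))))
      where
      ≢a₁ : ∀ i → (b₁ ∷ᶠ a₂ ∷ᶠ b₂ ∷ᶠ []ᶠ) i ≢ a₁
      ≢a₁ zero             = ∉cl∁≢∉cl a₁∉cl b₁∉cl ∘ sym
      ≢a₁ (suc zero)       = a₂≢a₁
      ≢a₁ (suc (suc zero)) = ∉cl∁≢∉cl a₁∉cl b₂∉cl ∘ sym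
      ≢b₁ : ∀ i → (a₂ ∷ᶠ b₂ ∷ᶠ []ᶠ) i ≢ b₁
      ≢b₁ zero       = ∉cl∁≢∉cl a₂∉cl b₁∉cl
      ≢b₁ (suc zero) = b₂≢b₁
      ≢a₂ : ∀ i → (b₂ ∷ᶠ []ᶠ) i ≢ a₂
      ≢a₂ zero = ∉cl∁≢∉cl a₂∉cl b₂∉cl ∘ sym

    quad∈D : ∀ i → quad i ∈ D
    quad∈D zero                   = a₁∈D
    quad∈D (suc zero)             = b₁∈D
    quad∈D (suc (suc zero))       = a₂∈D
    quad∈D (suc (suc (suc zero))) = b₂∈D

    Z C B : Subset (m M)
    Z = img quad ⊤
    C = D ─ Z
    B = D - b₂

    quad∉C : ∀ i → quad i ∉ C
    quad∉C i h = proj₂ (x∈p─q⁻ D Z h) (f∈img⊤ quad i)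

    ∈D⇒∈C⊎quad : ∀ {x} → x ∈ D → x ∈ C ⊎ Σ _ λ i → quad i ≡ x
    ∈D⇒∈C⊎quad {x} x∈D with x ∈? Z
    ... | no  x∉Z = inj₁ (x∈p∧x∉q⇒x∈p─q x∈D x∉Z)
    ... | yes x∈Z with img⁻ quad ⊤ x∈Z
    ...   | i , _ , qi≡x = inj₂ (i , qi≡x)

    C∪img⊆D : ∀ Y → C ∪ img quad Y ⊆ D
    C∪img⊆D Y h with x∈p∪q⁻ C (img quad Y) h
    ... | inj₁ c = p─q⊆p D Z c
    ... | inj₂ y with img⁻ quad Y y
    ...   | i , _ , refl = quad∈D i

    quad∉C∪img : ∀ Y i → i ∉ Y → quad i ∉ C ∪ img quad Y
    quad∉C∪img Y i i∉Y = ∉∪ (quad∉C i) qi∉img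
      where
      qi∉img : quad i ∉ img quad Y
      qi∉img h with img⁻ quad Y h
      ... | j , j∈Y , qj≡qi = i∉Y (subst (_∈ Y) (quad-injective j i qj≡qi) j∈Y)

    C∪img-indep : ∀ Y i → i ∉ Y → IndepF2 φ (C ∪ img quad Y)
    C∪img-indep Y i i∉Y = circuit-─-indep cD (C∪img⊆D Y) (quad∈D i) (quad∉C∪img Y i i∉Y)

    C∪img⊤-dep : ¬ IndepF2 φ (C ∪ img quad ⊤)
    C∪img⊤-dep ind = ind D D⊆ (proj₁ cD) (proj₁ (proj₂ cD))
      where
      D⊆ : D ⊆ C ∪ img quad ⊤
      D⊆ h with ∈D⇒∈C⊎quad h
      ... | inj₁ c = p⊆p∪q _ c
      ... | inj₂ (i , refl) = q⊆p∪q C _ (f∈img⊤ quad i)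

    indC : IndepF2 φ C
    indC = circuit-─-indep cD (p─q⊆p D Z) a₁∈D (quad∉C zero)

    C∪⁅quad⁆-indep : ∀ i → IndepF2 φ (C ∪ ⁅ quad i ⁆)
    C∪⁅quad⁆-indep i = subst (λ W → IndepF2 φ (C ∪ W)) (img-⁅⁆ quad i) (C∪img-indep ⁅ i ⁆ (other i) (x≢y⇒x∉⁅y⁆ (other≢ i)))
      where
      other : Fin 4 → Fin 4
      other zero    = suc zero
      other (suc _) = zero
      other≢ : ∀ i → other i ≢ i
      other≢ zero    ()
      other≢ (suc _) ()

    b₂∉B : b₂ ∉ B
    b₂∉B h = proj₂ (x∈p─q⁻ D _ h) (x∈⁅x⁆ b₂)

    C⊆B : C ⊆ B
    C⊆B c = x∈p∧x∉q⇒x∈p─q (p─q⊆p D Z c) (λ h → quad∉C (suc (suc (suc zero))) (subst (_∈ C) (x∈⁅y⁆⇒x≡y b₂ h) c))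

    indB : IndepF2 φ B
    indB = circuit-─-indep cD (p─q⊆p D _) b₂∈D b₂∉B

    ∣D∣≡1+∣B∣ : ∣ D ∣ ≡ suc ∣ B ∣
    ∣D∣≡1+∣B∣ = trans (sym (∣q∣+∣p─q∣≡∣p∣ D ⁅ b₂ ⁆ (x∈p⇒⁅x⁆⊆p b₂∈D))) (cong (_+ ∣ B ∣) (∣⁅x⁆∣≡1 b₂))

    F : Subset (m M)
    F = closure D

    representable : ∀ {e} → e ∈ F → e ∉ D → DoubleNegation (Σ _ λ T → T ⊆ B × ∑ T ≡ φ e)
    representable {e} e∈F e∉D = ¬¬-map representation (¬indep⇒ZeroSum ¬indBe)
      where
      e∉B : e ∉ B
      e∉B = e∉D ∘ p─q⊆p D _
      r<∣B∪e∣ : r M (B ∪ ⁅ e ⁆) < ∣ B ∪ ⁅ e ⁆ ∣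
      r<∣B∪e∣ = begin-strict
        r M (B ∪ ⁅ e ⁆)      ≤⟨ r-mono⊆ (∪⁅⁆⊆ (p⊆p∪q _ ∘ p─q⊆p D _) (q⊆p∪q D _ (x∈⁅x⁆ e))) ⟩
        r M (D ∪ ⁅ e ⁆)      ≤⟨ ∈decSubset⁻ (_∈cl? D) e∈F ⟩
        r M D                <⟨ ¬indep⇒r<∣∣ (λ ind → ind D ⊆-refl (proj₁ cD) (proj₁ (proj₂ cD))) ⟩
        ∣ D ∣                ≡⟨ trans ∣D∣≡1+∣B∣ (sym (∣p∪⁅x⁆∣≡1+∣p∣ B e∉B)) ⟩
        ∣ B ∪ ⁅ e ⁆ ∣        ∎
        where open ≤-Reasoning
      ¬indBe : ¬ IndepF2 φ (B ∪ ⁅ e ⁆)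
      ¬indBe ind = <-irrefl (r-indep ind) r<∣B∪e∣
      representation : (Σ _ λ Z′ → Z′ ⊆ B ∪ ⁅ e ⁆ × Nonempty Z′ × ZeroSum Z′) → Σ _ λ T → T ⊆ B × ∑ T ≡ φ e
      representation (Z′ , Z′⊆ , neZ′ , zZ′) with e ∈? Z′
      ... | yes e∈Z′ = Z′ - e , ⊆∪⁅⁆⇒-⊆ Z′⊆ , ZeroSum⇒∑-≡φ zZ′ e∈Z′
      ... | no  e∉Z′ = ⊥-elim (indB Z′ (⊆∪⁅⁆⇒⊆ Z′⊆ e∉Z′) neZ′ zZ′)

    open Contraction C indC

    _∩quad⊆_ : Subset (m M) → Subset 4 → Set
    K ∩quad⊆ Y = ∀ j → quad j ∈ K → j ∈ Y

    ⊆C∪img : ∀ {K} Y → K ⊆ D → K ∩quad⊆ Y → K ⊆ C ∪ img quad Y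
    ⊆C∪img Y K⊆D K∩quad⊆Y h with ∈D⇒∈C⊎quad (K⊆D h)
    ... | inj₁ c = p⊆p∪q _ c
    ... | inj₂ (j , refl) = q⊆p∪q C _ (img⁺ quad (K∩quad⊆Y j h))

    parallel-if-only-quad : ∀ {K e} i → K ⊆ D → K ∩quad⊆ ⁅ i ⁆ → ∑ K ≡ φ e → ρ (⁅ e ⁆ ∪ ⁅ quad i ⁆) ≡ 1
    parallel-if-only-quad i K⊆D K∩quad⊆i eq =
      ρ-parallel (quad∉C i) (C∪⁅quad⁆-indep i) (subst (λ W → _ ⊆ C ∪ W) (img-⁅⁆ quad i) (⊆C∪img ⁅ i ⁆ K⊆D K∩quad⊆i)) eq

    loop-if-no-quad : ∀ {K e} → K ⊆ D → K ∩quad⊆ ∅ → ∑ K ≡ φ e → ρ ⁅ e ⁆ ≡ 0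
    loop-if-no-quad {K} K⊆D K∩quad⊆∅ eq = ∈cl⇒ρ≡0 (∑⇒∈cl (circuit-─-indep cD K⊆D a₁∈D (a₁∉K)) K⊆C eq)
      where
      K⊆C : K ⊆ C
      K⊆C h with ∈D⇒∈C⊎quad (K⊆D h)
      ... | inj₁ c = c
      ... | inj₂ (j , refl) = ⊥-elim (∉⊥ (K∩quad⊆∅ j h))
      a₁∉K : a₁ ∉ K
      a₁∉K = quad∉C zero ∘ K⊆C

    data Kind (e : Fin (m M)) (T : Subset (m M)) : Set where
      loop     : ρ ⁅ e ⁆ ≡ 0 → Kind e T
      parallel : ∀ i → ρ (⁅ e ⁆ ∪ ⁅ quad i ⁆) ≡ 1 → Kind e T
      diagonal : a₁ ∈ T → a₂ ∈ T → b₁ ∉ T → Kind e T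

    quad-pattern : ∀ {T} → b₂ ∉ T → (d₁ : Dec (a₁ ∈ T)) (d₂ : Dec (b₁ ∈ T)) (d₃ : Dec (a₂ ∈ T)) →
                   T ∩quad⊆ (does d₁ ∷ does d₂ ∷ does d₃ ∷ false ∷ [])
    quad-pattern _    (yes _)  _        _        zero                   _ = here
    quad-pattern _    (no ¬a₁) _        _        zero                   h = ⊥-elim (¬a₁ h)
    quad-pattern _    _        (yes _)  _        (suc zero)             _ = there here
    quad-pattern _    _        (no ¬b₁) _        (suc zero)             h = ⊥-elim (¬b₁ h)
    quad-pattern _    _        _        (yes _)  (suc (suc zero))       _ = there (there here)
    quad-pattern _    _        _        (no ¬a₂) (suc (suc zero))       h = ⊥-elim (¬a₂ h)
    quad-pattern b₂∉T _        _        _        (suc (suc (suc zero))) h = ⊥-elim (b₂∉T h)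

    -- When T contains a₁, b₁ and a₂, its complement D ─ T also sums to φ e and meets the four only in b₂.
    classify : ∀ {e T} → e ∉ D → T ⊆ B → ∑ T ≡ φ e → Kind e T
    classify {e} {T} e∉D T⊆B eq = go (a₁ ∈? T) (b₁ ∈? T) (a₂ ∈? T)
      where
      T⊆D : T ⊆ D
      T⊆D = p─q⊆p D _ ∘ T⊆B
      b₂∉T : b₂ ∉ T
      b₂∉T = b₂∉B ∘ T⊆B
      go : Dec (a₁ ∈ T) → Dec (b₁ ∈ T) → Dec (a₂ ∈ T) → Kind e T
      go (no ¬a₁) (no ¬b₁) (no ¬a₂) = loop (loop-if-no-quad T⊆D (quad-pattern b₂∉T (no ¬a₁) (no ¬b₁) (no ¬a₂)) eq)
      go (yes a₁∈T) (no ¬b₁) (no ¬a₂) = parallel zero (parallel-if-only-quad zero T⊆D (quad-pattern b₂∉T (yes a₁∈T) (no ¬b₁) (no ¬a₂)) eq)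
      go (no ¬a₁) (yes b₁∈T) (no ¬a₂) = parallel (suc zero) (parallel-if-only-quad (suc zero) T⊆D (quad-pattern b₂∉T (no ¬a₁) (yes b₁∈T) (no ¬a₂)) eq)
      go (no ¬a₁) (no ¬b₁) (yes a₂∈T) = parallel (suc (suc zero)) (parallel-if-only-quad (suc (suc zero)) T⊆D (quad-pattern b₂∉T (no ¬a₁) (no ¬b₁) (yes a₂∈T)) eq)
      go (yes a₁∈T) (no ¬b₁) (yes a₂∈T) = diagonal a₁∈T a₂∈T ¬b₁
      go (yes a₁∈T) (yes b₁∈T) (no ¬a₂) = ⊥-elim (no-balanced-split T⊆D eq e∉D a₁∈T a₁∉cl b₁∈T b₁∉cl a₂∈D ¬a₂ a₂∉cl b₂∈D b₂∉T b₂∉cl)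
      go (no ¬a₁) (yes b₁∈T) (yes a₂∈T) = ⊥-elim (no-balanced-split T⊆D eq e∉D a₂∈T a₂∉cl b₁∈T b₁∉cl a₁∈D ¬a₁ a₁∉cl b₂∈D b₂∉T b₂∉cl)
      go (yes a₁∈T) (yes b₁∈T) (yes a₂∈T) = parallel (suc (suc (suc zero)))
        (parallel-if-only-quad (suc (suc (suc zero))) (p─q⊆p D T) only-b₂ (trans (ZeroSum⇒∑─≡∑ (proj₁ (proj₂ cD)) T⊆D) eq))
        where
        only-b₂ : (D ─ T) ∩quad⊆ ⁅ suc (suc (suc zero)) ⁆
        only-b₂ zero                   h = ⊥-elim (proj₂ (x∈p─q⁻ D T h) a₁∈T)
        only-b₂ (suc zero)             h = ⊥-elim (proj₂ (x∈p─q⁻ D T h) b₁∈T)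
        only-b₂ (suc (suc zero))       h = ⊥-elim (proj₂ (x∈p─q⁻ D T h) a₂∈T)
        only-b₂ (suc (suc (suc zero))) _ = x∈⁅x⁆ _

    record Diagonal (e : Fin (m M)) : Set where
      field
        rep   : Subset (m M)
        e∉D   : e ∉ D
        rep⊆B : rep ⊆ B
        ∑rep  : ∑ rep ≡ φ e
        a₁∈   : a₁ ∈ rep
        a₂∈   : a₂ ∈ rep
        b₁∉   : b₁ ∉ rep

    nonloops-covered : ∀ {n} (f : Fin n → Fin (m M)) → (∀ i → quad i ∈ img f ⊤) →
      (∀ {e} → e ∈ F → Diagonal e → Σ _ λ g → g ∈ img f ⊤ × ρ (⁅ e ⁆ ∪ ⁅ g ⁆) ≡ 1) →
      DoubleNegation (Covers F f)
    nonloops-covered f quad∈img diagonal-covered =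
      ¬¬-∀ λ e → ¬¬-→ λ e∈F → ¬¬-→ λ ρ≡1 → cover e∈F ρ≡1
      where
      Covered : Fin (m M) → Set
      Covered e = Σ _ λ g → g ∈ img f ⊤ × ρ (⁅ e ⁆ ∪ ⁅ g ⁆) ≡ 1
      nonloop : ∀ {e} → ρ ⁅ e ⁆ ≡ 1 → ρ ⁅ e ⁆ ≢ 0
      nonloop ρ≡1 ρ≡0 with trans (sym ρ≡0) ρ≡1
      ... | ()
      cover : ∀ {e} → e ∈ F → ρ ⁅ e ⁆ ≡ 1 → DoubleNegation (Covered e)
      cover {e} e∈F ρ≡1 with e ∈? D
      ... | yes e∈D with ∈D⇒∈C⊎quad e∈D
      ...   | inj₁ e∈C = ⊥-elim (nonloop ρ≡1 (∈cl⇒ρ≡0 (∈⇒∈cl e∈C)))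
      ...   | inj₂ (i , refl) = pure (quad i , quad∈img i , ρ-parallel (quad∉C i) (C∪⁅quad⁆-indep i) (q⊆p∪q C _) (sum-⁅⁆ φ (quad i)))
      cover {e} e∈F ρ≡1 | no e∉D = ¬¬-map by-kind (representable e∈F e∉D)
        where
        by-kind : (Σ _ λ T → T ⊆ B × ∑ T ≡ φ e) → Covered e
        by-kind (T , T⊆B , eq) with classify e∉D T⊆B eq
        ... | loop ρ≡0              = ⊥-elim (nonloop ρ≡1 ρ≡0)
        ... | parallel i ρ≡1′       = quad i , quad∈img i , ρ≡1′
        ... | diagonal a₁∈ a₂∈ b₁∉  = diagonal-covered e∈F (record { rep = T ; e∉D = e∉D ; rep⊆B = T⊆B ; ∑rep = eq ; a₁∈ = a₁∈ ; a₂∈ = a₂∈ ; b₁∉ = b₁∉ })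

    C∪quad-indep⇔ : ∀ Y → (T (isIndep-MC4 Y) → IndepF2 φ (C ∪ img quad Y)) × (IndepF2 φ (C ∪ img quad Y) → T (isIndep-MC4 Y))
    C∪quad-indep⇔ Y@(false ∷ _ ∷ _ ∷ _ ∷ [])       = (λ _ → C∪img-indep Y zero (λ ())) , _
    C∪quad-indep⇔ Y@(true ∷ false ∷ _ ∷ _ ∷ [])    = (λ _ → C∪img-indep Y (suc zero) (λ { (there ()) })) , _
    C∪quad-indep⇔ Y@(true ∷ true ∷ false ∷ _ ∷ []) = (λ _ → C∪img-indep Y (suc (suc zero)) (λ { (there (there ())) })) , _
    C∪quad-indep⇔ Y@(true ∷ true ∷ true ∷ false ∷ []) = (λ _ → C∪img-indep Y (suc (suc (suc zero))) (λ { (there (there (there ()))) })) , _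
    C∪quad-indep⇔ (true ∷ true ∷ true ∷ true ∷ [])  = (λ ()) , (⊥-elim ∘ C∪img⊤-dep)

    quad-realises-C4 : Realisation MC4
    quad-realises-C4 = record
      { f         = quad
      ; injective = quad-injective
      ; avoids    = quad∉C
      ; indep⇒    = λ Y → proj₁ (C∪quad-indep⇔ Y) ∘ proj₁ (IndepF2-MC4 Y)
      ; indep⇐    = λ Y → proj₂ (IndepF2-MC4 Y) ∘ proj₂ (C∪quad-indep⇔ Y)
      }

    module WithDiagonal {e₀} (diag : Diagonal e₀) where
      open Diagonal diag

      -- e₀ plays the edge 01 of K₄\e, so {e₀, a₁, a₂} and {e₀, b₁, b₂} are its triangles.
      quint : Fin 5 → Fin (m M)
      quint = e₀ ∷ᶠ quad

      rep⊆D : rep ⊆ D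
      rep⊆D = p─q⊆p D _ ∘ rep⊆B

      quint-injective : Injective quint
      quint-injective = ∷ᶠ-injective (λ i qi≡e₀ → e∉D (subst (_∈ D) qi≡e₀ (quad∈D i))) quad-injective

      quint∉C : ∀ i → quint i ∉ C
      quint∉C zero    = e∉D ∘ p─q⊆p D Z
      quint∉C (suc i) = quad∉C i

      ∪⁅e₀⁆⊆C∪img : ∀ {K} Y → K ⊆ D → K ∩quad⊆ Y → K ∪ ⁅ e₀ ⁆ ⊆ C ∪ img quint (true ∷ Y)
      ∪⁅e₀⁆⊆C∪img {K} Y K⊆D K∩quad⊆Y h with x∈p∪q⁻ K ⁅ e₀ ⁆ h
      ... | inj₂ e = q⊆p∪q C _ (p⊆p∪q _ e)
      ... | inj₁ k with x∈p∪q⁻ C (img quad Y) (⊆C∪img Y K⊆D K∩quad⊆Y k)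
      ...   | inj₁ c = p⊆p∪q _ c
      ...   | inj₂ q = q⊆p∪q C _ (q⊆p∪q ⁅ e₀ ⁆ _ q)

      dependent-if-represented : ∀ {K} Y → K ⊆ D → e₀ ∉ K → ∑ K ≡ φ e₀ → K ∩quad⊆ Y →
                                 ¬ IndepF2 φ (C ∪ img quint (true ∷ Y))
      dependent-if-represented Y K⊆D e₀∉K eq K∩quad⊆Y ind =
        ind _ (∪⁅e₀⁆⊆C∪img Y K⊆D K∩quad⊆Y) (e₀ , q⊆p∪q _ _ (x∈⁅x⁆ e₀)) (∑≡φ⇒ZeroSum e₀∉K eq)

      a-pair-dependent : ∀ {Y} → rep ∩quad⊆ Y → ¬ IndepF2 φ (C ∪ img quint (true ∷ Y))
      a-pair-dependent {Y} = dependent-if-represented Y rep⊆D (e∉D ∘ rep⊆D) ∑rep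

      b-pair-dependent : ∀ {Y} → (D ─ rep) ∩quad⊆ Y → ¬ IndepF2 φ (C ∪ img quint (true ∷ Y))
      b-pair-dependent {Y} = dependent-if-represented Y (p─q⊆p D rep) (e∉D ∘ p─q⊆p D rep)
                               (trans (ZeroSum⇒∑─≡∑ (proj₁ (proj₂ cD)) rep⊆D) ∑rep)

      independent-if-missing : ∀ Y r k → r ∉ Y → k ∉ Y → quad r ∈ rep → quad k ∉ rep →
                               IndepF2 φ (C ∪ img quint (true ∷ Y))
      independent-if-missing Y r k r∉Y k∉Y qr∈rep qk∉rep =
        IndepF2-⊆ (indep-extend indD-k A⊆D-k rep⊆D-k ∑rep qr∈rep (quad∉C∪img Y r r∉Y)) ⊆A∪e₀
        where
        A = C ∪ img quad Y
        qk∉D-k : quad k ∉ D - quad k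
        qk∉D-k h = proj₂ (x∈p─q⁻ D _ h) (x∈⁅x⁆ (quad k))
        indD-k : IndepF2 φ (D - quad k)
        indD-k = circuit-─-indep cD (p─q⊆p D _) (quad∈D k) qk∉D-k
        ⊆D-k : ∀ {K} → K ⊆ D → quad k ∉ K → K ⊆ D - quad k
        ⊆D-k K⊆D qk∉K h = x∈p∧x∉q⇒x∈p─q (K⊆D h) (λ h′ → qk∉K (subst (_∈ _) (x∈⁅y⁆⇒x≡y _ h′) h))
        A⊆D-k : A ⊆ D - quad k
        A⊆D-k = ⊆D-k (C∪img⊆D Y) (quad∉C∪img Y k k∉Y)
        rep⊆D-k : rep ⊆ D - quad k
        rep⊆D-k = ⊆D-k rep⊆D qk∉rep
        ⊆A∪e₀ : C ∪ img quint (true ∷ Y) ⊆ A ∪ ⁅ e₀ ⁆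
        ⊆A∪e₀ h with x∈p∪q⁻ C _ h
        ... | inj₁ c = p⊆p∪q _ (p⊆p∪q _ c)
        ... | inj₂ q with x∈p∪q⁻ ⁅ e₀ ⁆ (img quad Y) q
        ...   | inj₁ e = q⊆p∪q A _ e
        ...   | inj₂ y = p⊆p∪q _ (q⊆p∪q C _ y)

      b₂∉rep : b₂ ∉ rep
      b₂∉rep = b₂∉B ∘ rep⊆B

      rep∩quad : ∀ {y₂ y₄} → rep ∩quad⊆ (true ∷ y₂ ∷ true ∷ y₄ ∷ [])
      rep∩quad zero                   _ = here
      rep∩quad (suc zero)             h = ⊥-elim (b₁∉ h)
      rep∩quad (suc (suc zero))       _ = there (there here)
      rep∩quad (suc (suc (suc zero))) h = ⊥-elim (b₂∉rep h)

      D─rep∩quad : ∀ {y₁ y₃} → (D ─ rep) ∩quad⊆ (y₁ ∷ true ∷ y₃ ∷ true ∷ [])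
      D─rep∩quad zero                   h = ⊥-elim (proj₂ (x∈p─q⁻ D rep h) a₁∈)
      D─rep∩quad (suc zero)             _ = there here
      D─rep∩quad (suc (suc zero))       h = ⊥-elim (proj₂ (x∈p─q⁻ D rep h) a₂∈)
      D─rep∩quad (suc (suc (suc zero))) _ = there (there (there here))

      C∪quint-indep⇔ : ∀ Y → (T (isIndep-MK4e Y) → IndepF2 φ (C ∪ img quint Y)) × (IndepF2 φ (C ∪ img quint Y) → T (isIndep-MK4e Y))
      C∪quint-indep⇔ (false ∷ Y@(_ ∷ _ ∷ _ ∷ _ ∷ [])) =
        (λ t → IndepF2-⊆ (proj₁ (C∪quad-indep⇔ Y) t) (⊆-reflexive drop-∅)) ,
        (λ ind → proj₂ (C∪quad-indep⇔ Y) (IndepF2-⊆ ind (⊆-reflexive (sym drop-∅))))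
        where
        drop-∅ : C ∪ (∅ ∪ img quad Y) ≡ C ∪ img quad Y
        drop-∅ = cong (C ∪_) (∪-identityˡ (img quad Y))
      C∪quint-indep⇔ (true ∷ Y@(false ∷ false ∷ _ ∷ _ ∷ [])) =
        (λ _ → independent-if-missing Y zero (suc zero) (λ ()) (λ { (there ()) }) a₁∈ b₁∉) , _
      C∪quint-indep⇔ (true ∷ Y@(false ∷ true ∷ _ ∷ false ∷ [])) =
        (λ _ → independent-if-missing Y zero (suc (suc (suc zero))) (λ ()) (λ { (there (there (there ()))) }) a₁∈ b₂∉rep) , _
      C∪quint-indep⇔ (true ∷ false ∷ true ∷ _ ∷ true ∷ []) = (λ ()) , (⊥-elim ∘ b-pair-dependent D─rep∩quad)
      C∪quint-indep⇔ (true ∷ Y@(true ∷ false ∷ false ∷ _ ∷ [])) =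
        (λ _ → independent-if-missing Y (suc (suc zero)) (suc zero) (λ { (there (there ())) }) (λ { (there ()) }) a₂∈ b₁∉) , _
      C∪quint-indep⇔ (true ∷ Y@(true ∷ true ∷ false ∷ false ∷ [])) =
        (λ _ → independent-if-missing Y (suc (suc zero)) (suc (suc (suc zero))) (λ { (there (there ())) }) (λ { (there (there (there ()))) }) a₂∈ b₂∉rep) , _
      C∪quint-indep⇔ (true ∷ true ∷ true ∷ false ∷ true ∷ []) = (λ ()) , (⊥-elim ∘ b-pair-dependent D─rep∩quad)
      C∪quint-indep⇔ (true ∷ true ∷ _ ∷ true ∷ _ ∷ []) = (λ ()) , (⊥-elim ∘ a-pair-dependent rep∩quad)

      quint-realises-K4e : Realisation MK4e
      quint-realises-K4e = record
        { f         = quint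
        ; injective = quint-injective
        ; avoids    = quint∉C
        ; indep⇒    = λ Y → proj₁ (C∪quint-indep⇔ Y) ∘ proj₁ (IndepF2-MK4e Y)
        ; indep⇐    = λ Y → proj₂ (IndepF2-MK4e Y) ∘ proj₂ (C∪quint-indep⇔ Y)
        }

    diagonals-parallel : ∀ {e e′} → Diagonal e → Diagonal e′ → ρ (⁅ e′ ⁆ ∪ ⁅ e ⁆) ≡ 1
    diagonals-parallel {e} {e′} d d′ = ρ-parallel e∉C indC∪e K⊆ ∑K
      where
      module d  = Diagonal d
      module d′ = Diagonal d′
      e∉C : e ∉ C
      e∉C = d.e∉D ∘ p─q⊆p D Z
      indC∪e : IndepF2 φ (C ∪ ⁅ e ⁆)
      indC∪e = indep-extend indB C⊆B d.rep⊆B d.∑rep d.a₁∈ (quad∉C zero)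
      K = (d′.rep Δ d.rep) Δ ⁅ e ⁆
      ∑K : ∑ K ≡ φ e′
      ∑K = begin
        ∑ ((d′.rep Δ d.rep) Δ ⁅ e ⁆)       ≡⟨ sum-Δ φ _ ⁅ e ⁆ ⟩
        ∑ (d′.rep Δ d.rep) ⊕ ∑ ⁅ e ⁆       ≡⟨ cong₂ _⊕_ (sum-Δ φ d′.rep d.rep) (sum-⁅⁆ φ e) ⟩
        (∑ d′.rep ⊕ ∑ d.rep) ⊕ φ e         ≡⟨ cong (λ v → (∑ d′.rep ⊕ v) ⊕ φ e) d.∑rep ⟩
        (∑ d′.rep ⊕ φ e) ⊕ φ e             ≡⟨ ⊕-cancelʳ (∑ d′.rep) (φ e) ⟩
        ∑ d′.rep                           ≡⟨ d′.∑rep ⟩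
        φ e′                               ∎
        where open ≡-Reasoning
      in-C : ∀ {x} → x ∈ D → x ∈ d′.rep Δ d.rep → x ∈ C
      in-C x∈D h with ∈D⇒∈C⊎quad x∈D
      ... | inj₁ c = c
      ... | inj₂ (zero , refl)                 = ⊥-elim (x∈p∧x∈q⇒x∉pΔq d′.rep d.rep d′.a₁∈ d.a₁∈ h)
      ... | inj₂ (suc zero , refl)             = ⊥-elim (x∉p∧x∉q⇒x∉pΔq d′.rep d.rep d′.b₁∉ d.b₁∉ h)
      ... | inj₂ (suc (suc zero) , refl)       = ⊥-elim (x∈p∧x∈q⇒x∉pΔq d′.rep d.rep d′.a₂∈ d.a₂∈ h)
      ... | inj₂ (suc (suc (suc zero)) , refl) = ⊥-elim (x∉p∧x∉q⇒x∉pΔq d′.rep d.rep (b₂∉B ∘ d′.rep⊆B) (b₂∉B ∘ d.rep⊆B) h)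
      Δ⊆C : d′.rep Δ d.rep ⊆ C
      Δ⊆C h with x∈pΔq⁻ d′.rep d.rep h
      ... | inj₁ (x∈rep′ , _) = in-C (p─q⊆p D _ (d′.rep⊆B x∈rep′)) h
      ... | inj₂ (_ , x∈rep)  = in-C (p─q⊆p D _ (d.rep⊆B x∈rep)) h
      K⊆ : K ⊆ C ∪ ⁅ e ⁆
      K⊆ h with x∈pΔq⁻ (d′.rep Δ d.rep) ⁅ e ⁆ h
      ... | inj₁ (a , _) = p⊆p∪q _ (Δ⊆C a)
      ... | inj₂ (_ , b) = q⊆p∪q C _ b

    C⊆F : C ⊆ F
    C⊆F = ⊆-closure ∘ p─q⊆p D Z

    C4-minor : Covers F quad → HasInducedMinor M MC4
    C4-minor = realisation⇒inducedMinor closure-isFlat C⊆F rankF2-MC4 rankF2-MC4-⁅⁆ rankF2-MC4-pair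
                 quad-realises-C4 (⊆-closure ∘ quad∈D)

    K4e-minor : ∀ {e₀} → e₀ ∈ F → (d : Diagonal e₀) → Covers F (WithDiagonal.quint d) → HasInducedMinor M MK4e
    K4e-minor e₀∈F d = realisation⇒inducedMinor closure-isFlat C⊆F rankF2-MK4e rankF2-MK4e-⁅⁆ rankF2-MK4e-pair
                         (WithDiagonal.quint-realises-K4e d) quint∈F
      where
      quint∈F : ∀ i → WithDiagonal.quint d i ∈ F
      quint∈F zero    = e₀∈F
      quint∈F (suc i) = ⊆-closure (quad∈D i)

    C4-or-K4e : DoubleNegation (HasInducedMinor M MC4 ⊎ HasInducedMinor M MK4e)
    C4-or-K4e = do
      yes (e₀ , e₀∈F , d) ← ¬¬-excluded-middle {A = Σ _ λ e → e ∈ F × Diagonal e}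
        where no ¬diagonal → ¬¬-map (inj₁ ∘ C4-minor)
                (nonloops-covered quad (f∈img⊤ quad) (λ e∈F d → ⊥-elim (¬diagonal (_ , e∈F , d))))
      let open WithDiagonal d
      ¬¬-map (inj₂ ∘ K4e-minor e₀∈F d)
        (nonloops-covered quint (f∈img⊤ quint ∘ suc) (λ _ d′ → e₀ , f∈img⊤ quint zero , diagonals-parallel d d′))

Disconnected? : ∀ M → Dec (Disconnected M)
Disconnected? M = anySubset? λ X → nonempty? X ×-dec nonempty? (∁ X) ×-dec (r M X + r M (∁ X) ≟ⁿ r M ⊤)

VerticalSep⇒r∁<r⊤ : ∀ {M k X} → VerticalSep M k X → r M (∁ X) < r M ⊤
VerticalSep⇒r∁<r⊤ {M} {k} {X} (sum< , k≤rX , _) =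
  +-cancelˡ-< (r M X) _ _ (<-≤-trans sum< (+-monoˡ-≤ (r M ⊤) k≤rX))

VerticalSep⇒r<r⊤ : ∀ {M k X} → VerticalSep M k X → r M X < r M ⊤
VerticalSep⇒r<r⊤ {M} {k} {X} (sum< , _ , k≤r∁X) =
  +-cancelˡ-< (r M (∁ X)) _ _ (<-≤-trans (subst (_< k + r M ⊤) (+-comm (r M X) _) sum<) (+-monoˡ-≤ (r M ⊤) k≤r∁X))

separation⇒C4-or-K4e : ∀ M {k} (φ : Fin (m M) → Vec Bool k) → (∀ X → IsRankF2 φ X (r M X)) → ¬ Disconnected M →
  ∀ X → r M (∁ X) < r M ⊤ → r M X < r M ⊤ → DoubleNegation (HasInducedMinor M MC4 ⊎ HasInducedMinor M MK4e)
separation⇒C4-or-K4e M φ rk connected X ∁X<⊤ X<⊤ = do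
  (D , crossingD@(cD , (a₁ , a₁∈D , a₁∉cl) , (b₁ , b₁∈D , b₁∉cl)) , minimal) ← ¬¬-minimal (crossing-exists connected ∁X<⊤ X<⊤)
  (a₂ , a₂∈D , a₂≢a₁ , a₂∉cl) ← circuit-∉cl (∁ X) cD a₁∈D a₁∉cl
  (b₂ , b₂∈D , b₂≢b₁ , b₂∉cl) ← circuit-∉cl X cD b₁∈D b₁∉cl
  MinimalCrossing.FourElements.C4-or-K4e M φ rk X D crossingD minimal a₁ a₂ b₁ b₂
    a₁∈D a₂∈D b₁∈D b₂∈D a₁∉cl a₂∉cl b₁∉cl b₂∉cl a₂≢a₁ b₂≢b₁
  where
  open BinaryMatroid M φ rk
  open CrossingCircuits M φ rk X

lemma2p11 : (M : Matroid) → Simple M → Binary M →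
    ¬ HasInducedMinor M MC4 → ¬ HasInducedMinor M MK4e →
    Disconnected M ⊎ Round M
lemma2p11 M _ (_ , φ , rk) ¬C4 ¬K4e with Disconnected? M
... | yes disconnected = inj₁ disconnected
... | no  connected    = inj₂ λ _ _ X sep →
  separation⇒C4-or-K4e M φ rk connected X (VerticalSep⇒r∁<r⊤ {M} sep) (VerticalSep⇒r<r⊤ {M} sep) [ ¬C4 , ¬K4e ]′
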